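{- For every $m\in\mathbb{N}$ and every Turing functional $\Xi$, there is a $\Gamma_m$-functional $\Psi$ such that for every oracle $X$, if $\Xi^X$ is a $\Gamma_m$-approximation, then $\Psi^X$ has the same limit function as $\Xi^X$, i.e. $\lim_s\Psi^X(n,s)=\lim_s\Xi^X(n,s)$ for every $n$.
   Context: A tree $T_1\subseteq\mathbb{N}^{<\mathbb{N}}$ is a one-step variation of $T_0$ if there are $\xi\in T_0$ and non-empty finite $F\subseteq\mathbb{N}$ with either $\xi$ a leaf of $T_0$ and $T_1=T_0\cup\{\xi\cdot n:n\in F\}$, or $\xi$ not a leaf, $T_1=(T_0\setminus\{\eta:\eta\text{ strictly extends }\xi\})\cup\{\xi\cdot n:n\in F\}$ and $F\subsetneq\{n:\xi\cdot n\in T_0\}$. For a tree-order $(W,\preccurlyeq)$ with root $\zeta$, a computation path on $W$ is a finite sequence $(T_0,\varphi_0),\dots,(T_{u-1},\varphi_{u-1})$ of finite trees with $T_0=\{\varepsilon\}$, each $T_{j+1}$ a one-step variation of $T_j$, and order-preserving maps $\varphi_j:T_j\to W$ with $\varphi_j(\varepsilon)=\zeta$ and $\varphi_{j+1}=\varphi_j$ on $T_{j+1}\cap T_j$. $\Gamma_0$ is the set of finite-domain partial functions $\mathbb{N}\to3$, a depth-one tree with root $\zeta_0$ the empty function; $\Gamma_{m+1}$ is the set of computation paths on $\Gamma_m$, ordered by the prefix relation $\preccurlyeq_{m+1}$, with root $\zeta_{m+1}=((\{\varepsilon\},\varepsilon\mapsto\zeta_m))$; these are coded computably and have no infinite strictly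 increasing chains. Interpretation: $[\![\gamma]\!]=\{\gamma\}$ for $\gamma\in\Gamma_0$; for $\gamma=((T_j,\varphi_j))_{j<u}\in\Gamma_{m+1}$, $[\![\gamma]\!]=\bigcup_{\xi\text{ leaf of }T_{u-1}}[\![\varphi_{u-1}(\xi)]\!]$. $\gamma$ is over $n$ if each $h\in[\![\gamma]\!]$ has $\operatorname{dom}h\subseteq(n,\infty)$. A $\Gamma_m$-approximation is $g:\mathbb{N}^2\to\Gamma_m$ with $g(n,0)=\zeta_m$, $s\mapsto g(n,s)$ non-decreasing, and $g(n,s)$ over $n$ for all $n,s$. A $\Gamma_m$-functional is a Turing functional $\Psi$ such that for every oracle $X$, $\Psi^X$ is total and is a $\Gamma_m$-approximation. -}

module Defs where

open import Data.Nat using (ℕ; zero; suc; _+_; _*_; _<_; _≤_)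
open import Data.Fin using (Fin; toℕ)
open import Data.List using (List; []; _∷_; _++_; [_])
open import Data.List.Relation.Unary.Any using (Any)
open import Data.List.Relation.Unary.All using (All)
open import Data.List.Relation.Unary.Linked using (Linked)
open import Data.List.Membership.Propositional using (_∈_)
open import Data.Product using (Σ; ∃; ∃₂; _×_; _,_; proj₁; proj₂; ∃-syntax)
open import Data.Sum using (_⊎_)
open import Data.Vec as V using (Vec)
open import Data.Maybe using (Maybe; just; nothing; _>>=_)
open import Data.Bool using (Bool; true; false)
open import Data.Empty using (⊥)
open import Data.Unit using (⊤)
open import Relation.Binary.PropositionalEquality using (_≡_)
open import Relation.Nullary using (¬_)
open import Function.Bundles using (_⇔_)

-- Oracle computation: partial recursive functionals (Kleene's
-- mu-recursive functions relative to an oracle X : ℕ → Bool),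
-- with a fuel-indexed evaluator.  A Turing functional with two
-- inputs (n , s) is a term of type PR 2.

data PR : ℕ → Set where
  zeroF : ∀ {k} → PR k
  succF : PR 1
  proj  : ∀ {k} → Fin k → PR k
  orac  : PR 1
  comp  : ∀ {k l} → PR l → Vec (PR k) l → PR k
  prec  : ∀ {k} → PR k → PR (suc (suc k)) → PR (suc k)
  mu    : ∀ {k} → PR (suc k) → PR k

Oracle : Set
Oracle = ℕ → Bool

bit : Bool → ℕ
bit false = 0
bit true  = 1

ifZero : ℕ → Maybe ℕ → Maybe ℕ → Maybe ℕ
ifZero zero    a b = a
ifZero (suc _) a b = b

mutual
  eval : ℕ → Oracle → ∀ {k} → PR k → Vec ℕ k → Maybe ℕ
  eval zero    X _ _ = nothing
  eval (suc f) X zeroF xs = just 0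
  eval (suc f) X succF (x V.∷ V.[]) = just (suc x)
  eval (suc f) X (proj i) xs = just (V.lookup xs i)
  eval (suc f) X orac (x V.∷ V.[]) = just (bit (X x))
  eval (suc f) X (comp g hs) xs = evalAll f X hs xs >>= eval f X g
  eval (suc f) X (prec g h) (n V.∷ xs) = evalRec f X g h n xs
  eval (suc f) X (mu g) xs = search f f X g xs 0

  evalAll : ℕ → Oracle → ∀ {k l} → Vec (PR k) l → Vec ℕ k → Maybe (Vec ℕ l)
  evalAll f X V.[] xs = just V.[]
  evalAll f X (h V.∷ hs) xs =
    eval f X h xs >>= λ y → evalAll f X hs xs >>= λ ys → just (y V.∷ ys)

  evalRec : ℕ → Oracle → ∀ {k} → PR k → PR (suc (suc k)) → ℕ → Vec ℕ k → Maybe ℕ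
  evalRec f X g h zero xs = eval f X g xs
  evalRec f X g h (suc n) xs =
    evalRec f X g h n xs >>= λ r → eval f X h (n V.∷ r V.∷ xs)

  search : ℕ → ℕ → Oracle → ∀ {k} → PR (suc k) → Vec ℕ k → ℕ → Maybe ℕ
  search f zero    X g xs i = nothing
  search f (suc b) X g xs i =
    eval f X g (i V.∷ xs) >>= λ r → ifZero r (just i) (search f b X g xs (suc i))

Computes : PR 2 → Oracle → ℕ → ℕ → ℕ → Set
Computes Φ X n s y = ∃ λ f → eval f X Φ (n V.∷ s V.∷ V.[]) ≡ just y

Node : Set
Node = List ℕ

-- Γ_0 : finite partial functions ℕ → 3 as key-sorted association lists
-- Γ_{m+1} : sequences of steps (T_j , φ_j), a step being the finite
--           graph of φ_j : T_j → Γ_m, sorted lexicographically by node.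
G : ℕ → Set
G zero    = List (ℕ × Fin 3)
G (suc m) = List (List (Node × G m))

Step : ℕ → Set
Step m = List (Node × G m)

-- strict lexicographic order on nodes (used only for canonical sorting)
data _<ᴸ_ : Node → Node → Set where
  []<∷  : ∀ {y ys} → [] <ᴸ (y ∷ ys)
  head< : ∀ {x y xs ys} → x < y → (x ∷ xs) <ᴸ (y ∷ ys)
  tail< : ∀ {x xs ys} → xs <ᴸ ys → (x ∷ xs) <ᴸ (x ∷ ys)

ζ : (m : ℕ) → G m
ζ zero    = []
ζ (suc m) = [ [ ([] , ζ m) ] ]

Le : (m : ℕ) → G m → G m → Set
Le zero    γ δ = γ ≡ [] ⊎ γ ≡ δ           -- depth-one tree with root ζ_0
Le (suc m) γ δ = ∃ λ ρ → γ ++ ρ ≡ δ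

IsPrefix : Node → Node → Set
IsPrefix ξ η = ∃ λ ρ → ξ ++ ρ ≡ η

StrictExt : Node → Node → Set
StrictExt ξ η = ∃₂ λ k ρ → ξ ++ (k ∷ ρ) ≡ η

module _ {m : ℕ} where
  _∈ᵀ_ : Node → Step m → Set
  ξ ∈ᵀ T = Any (λ p → proj₁ p ≡ ξ) T

  IsLeaf : Node → Step m → Set
  IsLeaf ξ T = ∀ η → StrictExt ξ η → ¬ (η ∈ᵀ T)

  OneStep : Step m → Step m → Set
  OneStep T T' = ∃ λ ξ → ξ ∈ᵀ T × ∃ λ (F : List ℕ) → (∃ λ n → n ∈ F) ×
    ( (IsLeaf ξ T ×
        (∀ η → η ∈ᵀ T' ⇔ (η ∈ᵀ T ⊎ ∃ λ n → n ∈ F × η ≡ ξ ++ [ n ])))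
    ⊎ (¬ IsLeaf ξ T ×
        (∀ η → η ∈ᵀ T' ⇔ ((η ∈ᵀ T × ¬ StrictExt ξ η) ⊎ ∃ λ n → n ∈ F × η ≡ ξ ++ [ n ])) ×
        (∀ n → n ∈ F → (ξ ++ [ n ]) ∈ᵀ T) ×
        (∃ λ n → (ξ ++ [ n ]) ∈ᵀ T × ¬ (n ∈ F))) )

  Agree : Step m → Step m → Set
  Agree T T' = ∀ ξ v w → (ξ , v) ∈ T → (ξ , w) ∈ T' → v ≡ w

mutual
  Valid : (m : ℕ) → G m → Set
  Valid zero    γ = Linked (λ p q → proj₁ p < proj₁ q) γ
  Valid (suc m) γ = IsPath m γ

  -- (T , φ) : T a finite tree, φ : T → Γ_m order-preserving, φ(ε) = ζ_m
  ValidStep : (m : ℕ) → Step m → Set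
  ValidStep m T =
    Linked (λ p q → proj₁ p <ᴸ proj₁ q) T ×
    (∀ ξ η → IsPrefix ξ η → η ∈ᵀ T → ξ ∈ᵀ T) ×
    All (λ p → Valid m (proj₂ p)) T ×
    ([] , ζ m) ∈ T ×
    (∀ ξ η v w → (ξ , v) ∈ T → (η , w) ∈ T → IsPrefix ξ η → Le m v w)

  PathFrom : (m : ℕ) → Step m → List (Step m) → Set
  PathFrom m T []         = ⊤
  PathFrom m T (T' ∷ Ts)  = ValidStep m T' × OneStep T T' × Agree T T' × PathFrom m T' Ts

  IsPath : (m : ℕ) → List (Step m) → Set
  IsPath m []       = ⊥
  IsPath m (T ∷ Ts) = T ≡ [ ([] , ζ m) ] × PathFrom m T Ts

Interp : (m : ℕ) → G m → G zero → Set
Interp zero    γ h = h ≡ γ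
Interp (suc m) γ h = ∃ λ pre → ∃ λ T → pre ++ [ T ] ≡ γ ×
  ∃ λ ξ → ∃ λ w → (ξ , w) ∈ T × IsLeaf ξ T × Interp m w h

Over : (m : ℕ) → ℕ → G m → Set
Over m n γ = ∀ h → Interp m γ h → All (λ p → n < proj₁ p) h

IsApproxFn : (m : ℕ) → (ℕ → ℕ → G m) → Set
IsApproxFn m g =
  (∀ n s → Valid m (g n s)) ×
  (∀ n → g n 0 ≡ ζ m) ×
  (∀ n s t → s ≤ t → Le m (g n s) (g n t)) ×
  (∀ n s → Over m n (g n s))

tri : ℕ → ℕ
tri zero    = 0
tri (suc k) = suc k + tri k

cp : ℕ → ℕ → ℕ
cp a b = tri (a + b) + b

codeList : {A : Set} → (A → ℕ) → List A → ℕ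
codeList c []       = 0
codeList c (x ∷ xs) = suc (cp (c x) (codeList c xs))

code : (m : ℕ) → G m → ℕ
code zero    = codeList (λ p → cp (proj₁ p) (toℕ (proj₂ p)))
code (suc m) = codeList (codeList (λ p → cp (codeList (λ k → k) (proj₁ p)) (code m (proj₂ p))))

IsApproxOf : (m : ℕ) → PR 2 → Oracle → Set
IsApproxOf m Φ X = ∃ λ (g : ℕ → ℕ → G m) →
  IsApproxFn m g × (∀ n s → Computes Φ X n s (code m (g n s)))

IsΓFunctional : (m : ℕ) → PR 2 → Set
IsΓFunctional m Ψ = ∀ X → IsApproxOf m Ψ X

ConvergesTo : PR 2 → Oracle → ℕ → ℕ → Set
ConvergesTo Φ X n c = ∃ λ s₀ → ∀ s → s₀ ≤ s → Computes Φ X n s c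

SameLimit : PR 2 → PR 2 → Oracle → Set
SameLimit Φ Ψ X = ∀ n c → ConvergesTo Φ X n c ⇔ ConvergesTo Ψ X n c

{-# OPTIONS --safe #-}
-- Ψ^X(n, s) replays Ξ^X(n, 0), …, Ξ^X(n, s - 1), each with s steps of fuel, keeping the last
-- result that decodes to a valid Γ_m-object over n above the value kept so far, and freezes at the
-- first result that is not of this kind or has not converged.  Hence Ψ^X(n, ·) takes valid values
-- over n, starts at the root and is monotone, since more fuel only lets the replay get further.
-- If Ξ^X is a Γ_m-approximation g, then for every K and all large s every stage below K is
-- accepted, so Ψ^X(n, s) = g(n, j) for some j ≥ K; as g(n, ·) is monotone for an antisymmetric
-- order, Ψ^X(n, ·) and g(n, ·) then have the same limit.
-- Ψ is a Turing functional because the replay, including decision procedures on codes for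
-- validity, "over n" and the order, is written as a typed program that compiles to a primitive
-- recursive term together with a proof of what that term computes.
module Submission where

open import Defs
open import Data.Nat using (ℕ; zero; suc; _≤′_; ≤′-refl; ≤′-step; z<s; s≤s⁻¹; _+_; _∸_; _≤_; _<_; z≤n; s≤s; _⊔_; pred; _≡ᵇ_; _<ᵇ_)
open import Data.Nat.Properties
open import Data.Fin using (Fin; toℕ) renaming (zero to fz; suc to fs)
open import Data.Fin.Properties using (toℕ-injective)
open import Data.Vec as V using (Vec; []; _∷_)
open import Data.Vec.Properties using (map-∘; map-lookup-allFin)
open import Data.List as L using (List; []; _∷_; length; foldl; null; reverse; _++_; [_])
open import Data.List.Properties using (reverse-involutive; ∷-injectiveˡ; ∷-injectiveʳ; ∷ʳ-injective; ∷ʳ-injectiveʳ; length-++; length-take; take++drop≡id; ++-assoc; ++-identityʳ; ++-identityʳ-unique; ++-conicalˡ)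
open import Data.List.Relation.Unary.Any as Any using (Any; here; there)
open import Data.List.Relation.Unary.All as All using (All; []; _∷_)
open import Data.List.Relation.Unary.Linked using (Linked; []; [-]; _∷_)
open import Data.List.Membership.Propositional using (_∈_; find; lose)
open import Data.Bool using (Bool; true; false; not; _∧_; _∨_; if_then_else_; T)
open import Data.Bool.Properties using (∧-assoc; ∧-identityʳ; ∨-assoc; ∨-identityʳ)
open import Data.Maybe using (Maybe; just; nothing; _>>=_; is-just)
open import Data.Maybe.Properties using (just-injective)
open import Data.Product using (∃; _×_; _,_; proj₁; proj₂)
open import Data.Sum using (_⊎_; inj₁; inj₂; [_,_]′)
open import Data.Unit using (⊤; tt)
open import Function.Bundles using (_⇔_; mk⇔; Equivalence)
open import Relation.Nullary using (¬_; Dec; yes; no; _because_; contradiction)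
open import Relation.Nullary.Reflects using (Reflects; ofʸ; ofⁿ; fromEquivalence; T-reflects; ¬-reflects; _×-reflects_; _⊎-reflects_; _→-reflects_)
open import Relation.Binary.Definitions using (tri<; tri≈; tri>)
open import Function using (_∘_; id; case_of_)
open import Relation.Binary.PropositionalEquality hiding ([_])
open ≡-Reasoning

-- Fuel-bounded evaluation

>>=-just-inv : {A B : Set} (mx : Maybe A) (k : A → Maybe B) {y : B} →
  (mx >>= k) ≡ just y → ∃ λ x → mx ≡ just x × k x ≡ just y
>>=-just-inv (just x) k e = x , refl , e
>>=-just-inv nothing k ()

upward-closed : {P : ℕ → Set} → (∀ {f} → P f → P (suc f)) → ∀ {f f′} → f ≤ f′ → P f → P f′
upward-closed {P} step le = go (≤⇒≤′ le)
  where
  go : ∀ {f f′} → f ≤′ f′ → P f → P f′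
  go ≤′-refl p = p
  go (≤′-step le) p = step (go le p)

mutual
  eval-suc : ∀ f X {k} (t : PR k) xs {y} → eval f X t xs ≡ just y → eval (suc f) X t xs ≡ just y
  eval-suc zero X t xs ()
  eval-suc (suc f) X zeroF xs e = e
  eval-suc (suc f) X succF (x ∷ []) e = e
  eval-suc (suc f) X (proj i) xs e = e
  eval-suc (suc f) X orac (x ∷ []) e = e
  eval-suc (suc f) X (comp g hs) xs e with >>=-just-inv (evalAll f X hs xs) (eval f X g) e
  ... | ys , e₁ , e₂ rewrite evalAll-suc f X hs xs e₁ = eval-suc f X g ys e₂
  eval-suc (suc f) X (prec g h) (n ∷ xs) e = evalRec-suc f X g h n xs e
  eval-suc (suc f) X (mu g) xs e = search-suc-bound (suc f) f X g xs 0 (search-suc-fuel f f X g xs 0 e)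

  evalAll-suc : ∀ f X {k l} (hs : Vec (PR k) l) xs {ys} → evalAll f X hs xs ≡ just ys → evalAll (suc f) X hs xs ≡ just ys
  evalAll-suc f X [] xs e = e
  evalAll-suc f X (h ∷ hs) xs e with >>=-just-inv (eval f X h xs) _ e
  ... | y , e₁ , e₂ with >>=-just-inv (evalAll f X hs xs) _ e₂
  ... | ys , e₃ , e₄ rewrite eval-suc f X h xs e₁ | evalAll-suc f X hs xs e₃ = e₄

  evalRec-suc : ∀ f X {k} (g : PR k) h n xs {y} → evalRec f X g h n xs ≡ just y → evalRec (suc f) X g h n xs ≡ just y
  evalRec-suc f X g h zero xs e = eval-suc f X g xs e
  evalRec-suc f X g h (suc n) xs e with >>=-just-inv (evalRec f X g h n xs) _ e
  ... | r , e₁ , e₂ rewrite evalRec-suc f X g h n xs e₁ = eval-suc f X h _ e₂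

  search-suc-fuel : ∀ f b X {k} (g : PR (suc k)) xs i {y} → search f b X g xs i ≡ just y → search (suc f) b X g xs i ≡ just y
  search-suc-fuel f zero X g xs i ()
  search-suc-fuel f (suc b) X g xs i e with >>=-just-inv (eval f X g (i ∷ xs)) _ e
  ... | zero , e₁ , e₂ rewrite eval-suc f X g _ e₁ = e₂
  ... | suc r , e₁ , e₂ rewrite eval-suc f X g _ e₁ = search-suc-fuel f b X g xs (suc i) e₂

  search-suc-bound : ∀ f b X {k} (g : PR (suc k)) xs i {y} → search f b X g xs i ≡ just y → search f (suc b) X g xs i ≡ just y
  search-suc-bound f zero X g xs i ()
  search-suc-bound f (suc b) X g xs i e with >>=-just-inv (eval f X g (i ∷ xs)) _ e
  ... | zero , e₁ , e₂ rewrite e₁ = e₂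
  ... | suc r , e₁ , e₂ rewrite e₁ = search-suc-bound f b X g xs (suc i) e₂

eval-mono : ∀ {f f′} X {k} (t : PR k) xs {y} → f ≤ f′ → eval f X t xs ≡ just y → eval f′ X t xs ≡ just y
eval-mono X t xs = upward-closed (λ {f} → eval-suc f X t xs)

evalAll-mono : ∀ {f f′} X {k l} (hs : Vec (PR k) l) xs {ys} → f ≤ f′ → evalAll f X hs xs ≡ just ys → evalAll f′ X hs xs ≡ just ys
evalAll-mono X hs xs = upward-closed (λ {f} → evalAll-suc f X hs xs)

evalRec-mono : ∀ {f f′} X {k} (g : PR k) h n xs {y} → f ≤ f′ → evalRec f X g h n xs ≡ just y → evalRec f′ X g h n xs ≡ just y
evalRec-mono X g h n xs = upward-closed (λ {f} → evalRec-suc f X g h n xs)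

eval-det : ∀ f f′ X {k} (t : PR k) xs {y y′} → eval f X t xs ≡ just y → eval f′ X t xs ≡ just y′ → y ≡ y′
eval-det f f′ X t xs e e′ =
  just-injective (trans (sym (eval-mono X t xs (m≤m⊔n f f′) e)) (eval-mono X t xs (m≤n⊔m f f′) e′))

Outputs : ∀ {k} → PR k → Oracle → Vec ℕ k → ℕ → Set
Outputs t X xs y = ∃ λ f → eval f X t xs ≡ just y

OutputsAll : ∀ {k l} → Vec (PR k) l → Oracle → Vec ℕ k → Vec ℕ l → Set
OutputsAll hs X xs ys = ∃ λ f → evalAll f X hs xs ≡ just ys

outputs-det : ∀ {k} {t : PR k} {X xs y y′} → Outputs t X xs y → Outputs t X xs y′ → y ≡ y′
outputs-det {t = t} {X} {xs} (f , e) (f′ , e′) = eval-det f f′ X t xs e e′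

outputsAll-[] : ∀ {k} X (xs : Vec ℕ k) → OutputsAll [] X xs []
outputsAll-[] X xs = 1 , refl

outputsAll-∷ : ∀ {k l} X {h : PR k} {hs : Vec (PR k) l} {xs y ys} →
  Outputs h X xs y → OutputsAll hs X xs ys → OutputsAll (h ∷ hs) X xs (y ∷ ys)
outputsAll-∷ X {h} {hs} {xs} (f₁ , e₁) (f₂ , e₂) =
  f₁ ⊔ f₂ , cong₂ (λ my mys → my >>= λ y → mys >>= λ ys → just (y ∷ ys))
                  (eval-mono X h xs (m≤m⊔n f₁ f₂) e₁) (evalAll-mono X hs xs (m≤n⊔m f₁ f₂) e₂)

outputs-comp : ∀ {k l} X {g : PR l} {hs : Vec (PR k) l} {xs ys y} →
  OutputsAll hs X xs ys → Outputs g X ys y → Outputs (comp g hs) X xs y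
outputs-comp X {g} {hs} {xs} {ys} (f₁ , e₁) (f₂ , e₂) =
  suc (f₁ ⊔ f₂) , trans (cong (_>>= eval (f₁ ⊔ f₂) X g) (evalAll-mono X hs xs (m≤m⊔n f₁ f₂) e₁))
                        (eval-mono X g ys (m≤n⊔m f₁ f₂) e₂)

outputs-prec : ∀ {k} X {g : PR k} {h : PR (suc (suc k))} {xs} (R : ℕ → ℕ) →
  Outputs g X xs (R 0) → (∀ i → Outputs h X (i ∷ R i ∷ xs) (R (suc i))) →
  ∀ n → Outputs (prec g h) X (n ∷ xs) (R n)
outputs-prec X {g} {h} {xs} R base step n = let f , e = evalRec-outputs n in suc f , e
  where
  evalRec-outputs : ∀ n → ∃ λ f → evalRec f X g h n xs ≡ just (R n)
  evalRec-outputs zero = base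
  evalRec-outputs (suc n) with evalRec-outputs n | step n
  ... | f₁ , e₁ | f₂ , e₂ =
    f₁ ⊔ f₂ , trans (cong (_>>= λ r → eval (f₁ ⊔ f₂) X h (n ∷ r ∷ xs)) (evalRec-mono X g h n xs (m≤m⊔n f₁ f₂) e₁))
                    (eval-mono X h _ (m≤n⊔m f₁ f₂) e₂)

-- Typed programs compiled to primitive recursive terms

data Ty : Set where
  nat bool fin3 : Ty
  list : Ty → Ty
  pair : Ty → Ty → Ty
  gam : ℕ → Ty

⟦_⟧ : Ty → Set
⟦ nat ⟧ = ℕ
⟦ bool ⟧ = Bool
⟦ fin3 ⟧ = Fin 3
⟦ list τ ⟧ = List ⟦ τ ⟧
⟦ pair σ τ ⟧ = ⟦ σ ⟧ × ⟦ τ ⟧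
⟦ gam m ⟧ = G m

encode : (τ : Ty) → ⟦ τ ⟧ → ℕ
encode nat x = x
encode bool b = bit b
encode fin3 x = toℕ x
encode (list τ) xs = codeList (encode τ) xs
encode (pair σ τ) (x , y) = cp (encode σ x) (encode τ y)
encode (gam m) γ = code m γ

Ctx : ℕ → Set
Ctx = Vec Ty

private
  variable
    k l n : ℕ
    Γ Δ : Ctx n
    σ σ₁ σ₂ σ₃ τ : Ty

Env : Ctx n → Set
Env [] = ⊤
Env (τ ∷ Γ) = ⟦ τ ⟧ × Env Γ

encodeEnv : (Γ : Ctx n) → Env Γ → Vec ℕ n
encodeEnv [] _ = []
encodeEnv (τ ∷ Γ) (x , ρ) = encode τ x ∷ encodeEnv Γ ρ

record Prog (Γ : Ctx n) (τ : Ty) : Set where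
  field
    sem : Oracle → Env Γ → ⟦ τ ⟧
    term : PR n
    computes : ∀ X ρ → Outputs term X (encodeEnv Γ ρ) (encode τ (sem X ρ))
open Prog public

data _∋_ : Ctx n → Ty → Set where
  here : (τ ∷ Γ) ∋ τ
  there : Γ ∋ τ → (σ ∷ Γ) ∋ τ

lookupEnv : Γ ∋ τ → Env Γ → ⟦ τ ⟧
lookupEnv here (x , _) = x
lookupEnv (there v) (_ , ρ) = lookupEnv v ρ

toFin : {Γ : Ctx n} → Γ ∋ τ → Fin n
toFin here = fz
toFin (there v) = fs (toFin v)

lookup-encodeEnv : (v : Γ ∋ τ) (ρ : Env Γ) → V.lookup (encodeEnv Γ ρ) (toFin v) ≡ encode τ (lookupEnv v ρ)
lookup-encodeEnv here ρ = refl
lookup-encodeEnv (there v) (_ , ρ) = lookup-encodeEnv v ρ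

var : Γ ∋ τ → Prog Γ τ
var v = record { sem = λ _ → lookupEnv v ; term = proj (toFin v) ; computes = λ _ ρ → 1 , cong just (lookup-encodeEnv v ρ) }

v₀ : Prog (τ ∷ Γ) τ
v₀ = var here

v₁ : Prog (σ ∷ τ ∷ Γ) τ
v₁ = var (there here)

v₂ : Prog (σ₁ ∷ σ₂ ∷ τ ∷ Γ) τ
v₂ = var (there (there here))

v₃ : Prog (σ₁ ∷ σ₂ ∷ σ₃ ∷ τ ∷ Γ) τ
v₃ = var (there (there (there here)))

data _⊑_ : Ctx n → Ctx l → Set where
  refl⊑ : Γ ⊑ Γ
  skip : Γ ⊑ Δ → Γ ⊑ (τ ∷ Δ)
  []⊑ : [] ⊑ Δ

thinEnv : Γ ⊑ Δ → Env Δ → Env Γ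
thinEnv refl⊑ ρ = ρ
thinEnv (skip θ) (_ , ρ) = thinEnv θ ρ
thinEnv []⊑ ρ = tt

thinIndices : {Γ : Ctx n} {Δ : Ctx l} → Γ ⊑ Δ → Vec (Fin l) n
thinIndices {n = n} refl⊑ = V.allFin n
thinIndices (skip θ) = V.map fs (thinIndices θ)
thinIndices []⊑ = []

lookup-thinIndices : (θ : Γ ⊑ Δ) (ρ : Env Δ) →
  V.map (V.lookup (encodeEnv Δ ρ)) (thinIndices θ) ≡ encodeEnv Γ (thinEnv θ ρ)
lookup-thinIndices {Δ = Δ} refl⊑ ρ = map-lookup-allFin (encodeEnv Δ ρ)
lookup-thinIndices (skip {Δ = Δ} {τ = τ} θ) (x , ρ) =
  trans (sym (map-∘ (V.lookup (encode τ x ∷ encodeEnv Δ ρ)) fs (thinIndices θ))) (lookup-thinIndices θ ρ)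
lookup-thinIndices []⊑ ρ = refl

evalAll-projections : ∀ X (xs : Vec ℕ k) (is : Vec (Fin k) n) → evalAll 1 X (V.map proj is) xs ≡ just (V.map (V.lookup xs) is)
evalAll-projections X xs [] = refl
evalAll-projections X xs (i ∷ is) rewrite evalAll-projections X xs is = refl

outputsAll-thin : ∀ X (θ : Γ ⊑ Δ) ρ → OutputsAll (V.map proj (thinIndices θ)) X (encodeEnv Δ ρ) (encodeEnv Γ (thinEnv θ ρ))
outputsAll-thin X θ ρ = 1 , trans (evalAll-projections X _ (thinIndices θ)) (cong just (lookup-thinIndices θ ρ))

data Sub (Δ : Ctx l) : Ctx n → Set where
  thin : Γ ⊑ Δ → Sub Δ Γ
  _∷ₛ_ : Prog Δ σ → Sub Δ Γ → Sub Δ (σ ∷ Γ)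
infixr 5 _∷ₛ_

semSub : Sub Δ Γ → Oracle → Env Δ → Env Γ
semSub (thin θ) X ρ = thinEnv θ ρ
semSub (p ∷ₛ s) X ρ = sem p X ρ , semSub s X ρ

termSub : {Δ : Ctx l} {Γ : Ctx n} → Sub Δ Γ → Vec (PR l) n
termSub (thin θ) = V.map proj (thinIndices θ)
termSub (p ∷ₛ s) = term p ∷ termSub s

outputsAll-termSub : (s : Sub Δ Γ) → ∀ X ρ → OutputsAll (termSub s) X (encodeEnv Δ ρ) (encodeEnv Γ (semSub s X ρ))
outputsAll-termSub (thin θ) X ρ = outputsAll-thin X θ ρ
outputsAll-termSub (p ∷ₛ s) X ρ = outputsAll-∷ X {h = term p} {hs = termSub s} (computes p X ρ) (outputsAll-termSub s X ρ)

subᴾ : Prog Γ τ → Sub Δ Γ → Prog Δ τ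
subᴾ p s = record
  { sem = λ X ρ → sem p X (semSub s X ρ)
  ; term = comp (term p) (termSub s)
  ; computes = λ X ρ → outputs-comp X (outputsAll-termSub s X ρ) (computes p X (semSub s X ρ)) }

letᴾ : Prog Γ σ → Prog (σ ∷ Γ) τ → Prog Γ τ
letᴾ e b = subᴾ b (e ∷ₛ thin refl⊑)

wkᴾ : Prog Γ τ → Prog (σ ∷ Γ) τ
wkᴾ p = subᴾ p (thin (skip refl⊑))

wk²ᴾ : Prog Γ τ → Prog (σ₁ ∷ σ₂ ∷ Γ) τ
wk²ᴾ p = subᴾ p (thin (skip (skip refl⊑)))

wk₁ᴾ : Prog (σ ∷ Γ) τ → Prog (σ ∷ σ₁ ∷ Γ) τ
wk₁ᴾ p = subᴾ p (v₀ ∷ₛ thin (skip (skip refl⊑)))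

app₁ : Prog (σ ∷ []) τ → Prog Γ σ → Prog Γ τ
app₁ f a = subᴾ f (a ∷ₛ thin []⊑)

app₂ : Prog (σ₁ ∷ σ₂ ∷ []) τ → Prog Γ σ₁ → Prog Γ σ₂ → Prog Γ τ
app₂ f a b = subᴾ f (a ∷ₛ b ∷ₛ thin []⊑)

app₃ : Prog (σ₁ ∷ σ₂ ∷ σ₃ ∷ []) τ → Prog Γ σ₁ → Prog Γ σ₂ → Prog Γ σ₃ → Prog Γ τ
app₃ f a b c = subᴾ f (a ∷ₛ b ∷ₛ c ∷ₛ thin []⊑)

numeral : ℕ → PR n
numeral zero = zeroF
numeral (suc k) = comp succF (numeral k ∷ [])

outputs-numeral : ∀ X (xs : Vec ℕ n) k → Outputs (numeral k) X xs k
outputs-numeral X xs zero = 1 , refl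
outputs-numeral X xs (suc k) =
  outputs-comp X {g = succF} (outputsAll-∷ X {h = numeral k} {hs = []} (outputs-numeral X xs k) (outputsAll-[] X xs)) (1 , refl)

lit : (τ : Ty) → ⟦ τ ⟧ → Prog Γ τ
lit τ v = record { sem = λ _ _ → v ; term = numeral (encode τ v) ; computes = λ X _ → outputs-numeral X _ (encode τ v) }

natrec : {A : Set} → A → (ℕ → A → A) → ℕ → A
natrec z s zero = z
natrec z s (suc n) = s n (natrec z s n)

natrecᴾ : Prog Γ nat → Prog Γ τ → Prog (nat ∷ τ ∷ Γ) τ → Prog Γ τ
natrecᴾ {Γ = Γ} {τ = τ} N z b = record
  { sem = λ X ρ → natrec (sem z X ρ) (λ i a → sem b X (i , a , ρ)) (sem N X ρ)
  ; term = comp (prec (term z) (term b)) (term N ∷ V.map proj (thinIndices (refl⊑ {Γ = Γ})))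
  ; computes = λ X ρ → outputs-comp X {g = prec (term z) (term b)}
      (outputsAll-∷ X {h = term N} {hs = V.map proj (thinIndices (refl⊑ {Γ = Γ}))} (computes N X ρ) (outputsAll-thin X refl⊑ ρ))
      (outputs-prec X (λ i → encode τ (natrec (sem z X ρ) (λ i a → sem b X (i , a , ρ)) i)) (computes z X ρ)
        (λ i → computes b X (i , natrec (sem z X ρ) (λ i a → sem b X (i , a , ρ)) i , ρ)) (sem N X ρ)) }

sucᴾ : Prog Γ nat → Prog Γ nat
sucᴾ = app₁ (record { sem = λ _ (x , _) → suc x ; term = succF ; computes = λ _ _ → 1 , refl })

oracleᴾ : Prog Γ nat → Prog Γ nat
oracleᴾ = app₁ (record { sem = λ X (x , _) → bit (X x) ; term = orac ; computes = λ _ _ → 1 , refl })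

reinterpret : (p : Prog Γ σ) (f : Oracle → Env Γ → ⟦ τ ⟧) → (∀ X ρ → encode σ (sem p X ρ) ≡ encode τ (f X ρ)) → Prog Γ τ
reinterpret p f e = record { sem = f ; term = term p ; computes = λ X ρ → subst (Outputs (term p) X _) (e X ρ) (computes p X ρ) }

withSem : (p : Prog Γ τ) (f : Oracle → Env Γ → ⟦ τ ⟧) → (∀ X ρ → sem p X ρ ≡ f X ρ) → Prog Γ τ
withSem {τ = τ} p f e = reinterpret p f (λ X ρ → cong (encode τ) (e X ρ))

-- Arithmetic and Cantor pairing

infixl 6 _+ᴾ_ _∸ᴾ_
infix 4 _==ᴾ_ _<ᴾ_
infixr 6 _∧ᴾ_
infixr 5 _∨ᴾ_
infix 0 ifᴾ_then_else_

predᴾ : Prog Γ nat → Prog Γ nat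
predᴾ n = withSem (natrecᴾ n (lit nat 0) v₀) (λ X ρ → pred (sem n X ρ)) (λ X ρ → natrec-pred (sem n X ρ))
  where
  natrec-pred : ∀ x → natrec 0 (λ i _ → i) x ≡ pred x
  natrec-pred zero = refl
  natrec-pred (suc x) = refl

_+ᴾ_ : Prog Γ nat → Prog Γ nat → Prog Γ nat
a +ᴾ b = withSem (natrecᴾ a b (sucᴾ v₁)) (λ X ρ → sem a X ρ + sem b X ρ) (λ X ρ → natrec-+ (sem a X ρ) (sem b X ρ))
  where
  natrec-+ : ∀ x y → natrec y (λ _ r → suc r) x ≡ x + y
  natrec-+ zero y = refl
  natrec-+ (suc x) y = cong suc (natrec-+ x y)

_∸ᴾ_ : Prog Γ nat → Prog Γ nat → Prog Γ nat
a ∸ᴾ b = withSem (natrecᴾ b a (predᴾ v₁)) (λ X ρ → sem a X ρ ∸ sem b X ρ) (λ X ρ → natrec-∸ (sem a X ρ) (sem b X ρ))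
  where
  natrec-∸ : ∀ x y → natrec x (λ _ r → pred r) y ≡ x ∸ y
  natrec-∸ x zero = refl
  natrec-∸ x (suc y) = trans (cong pred (natrec-∸ x y)) (pred[m∸n]≡m∸[1+n] x y)

bitᴾ : Prog Γ bool → Prog Γ nat
bitᴾ c = reinterpret c (λ X ρ → bit (sem c X ρ)) (λ _ _ → refl)

ifᴾ_then_else_ : Prog Γ bool → Prog Γ τ → Prog Γ τ → Prog Γ τ
ifᴾ c then t else e = withSem (natrecᴾ (bitᴾ c) e (wk²ᴾ t))
  (λ X ρ → if sem c X ρ then sem t X ρ else sem e X ρ) (λ X ρ → natrec-bit (sem c X ρ))
  where
  natrec-bit : {A : Set} {x y : A} (b : Bool) → natrec y (λ _ _ → x) (bit b) ≡ (if b then x else y)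
  natrec-bit false = refl
  natrec-bit true = refl

notᴾ : Prog Γ bool → Prog Γ bool
notᴾ a = withSem (ifᴾ a then lit bool false else lit bool true) (λ X ρ → not (sem a X ρ)) (λ X ρ → if-not (sem a X ρ))
  where
  if-not : ∀ b → (if b then false else true) ≡ not b
  if-not false = refl
  if-not true = refl

_∧ᴾ_ : Prog Γ bool → Prog Γ bool → Prog Γ bool
a ∧ᴾ b = withSem (ifᴾ a then b else lit bool false) (λ X ρ → sem a X ρ ∧ sem b X ρ) (λ X ρ → if-∧ (sem a X ρ))
  where
  if-∧ : ∀ {y} x → (if x then y else false) ≡ x ∧ y
  if-∧ false = refl
  if-∧ true = refl

_∨ᴾ_ : Prog Γ bool → Prog Γ bool → Prog Γ bool
a ∨ᴾ b = withSem (ifᴾ a then lit bool true else b) (λ X ρ → sem a X ρ ∨ sem b X ρ) (λ X ρ → if-∨ (sem a X ρ))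
  where
  if-∨ : ∀ {y} x → (if x then true else y) ≡ x ∨ y
  if-∨ false = refl
  if-∨ true = refl

isZeroᴾ : Prog Γ nat → Prog Γ bool
isZeroᴾ n = withSem (natrecᴾ n (lit bool true) (lit bool false)) (λ X ρ → sem n X ρ ≡ᵇ 0) (λ X ρ → natrec-isZero (sem n X ρ))
  where
  natrec-isZero : ∀ x → natrec true (λ _ _ → false) x ≡ (x ≡ᵇ 0)
  natrec-isZero zero = refl
  natrec-isZero (suc x) = refl

codeᴾ : Prog Γ τ → Prog Γ nat
codeᴾ {τ = τ} p = reinterpret p (λ X ρ → encode τ (sem p X ρ)) (λ _ _ → refl)

-- Equality is decided on codes, which is faithful by encode-injective below.
_==ᴾ_ : Prog Γ τ → Prog Γ τ → Prog Γ bool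
a ==ᴾ b = app₂ (withSem (isZeroᴾ ((v₀ ∸ᴾ v₁) +ᴾ (v₁ ∸ᴾ v₀))) (λ _ (x , y , _) → x ≡ᵇ y) λ _ (x , y , _) → ∸-symmetric-≡ᵇ x y)
                (codeᴾ a) (codeᴾ b)
  where
  ∸-symmetric-≡ᵇ : ∀ x y → ((x ∸ y) + (y ∸ x) ≡ᵇ 0) ≡ (x ≡ᵇ y)
  ∸-symmetric-≡ᵇ zero zero = refl
  ∸-symmetric-≡ᵇ zero (suc y) = refl
  ∸-symmetric-≡ᵇ (suc x) zero = refl
  ∸-symmetric-≡ᵇ (suc x) (suc y) = ∸-symmetric-≡ᵇ x y

_<ᴾ_ : Prog Γ nat → Prog Γ nat → Prog Γ bool
a <ᴾ b = withSem (notᴾ (isZeroᴾ (b ∸ᴾ a))) (λ X ρ → sem a X ρ <ᵇ sem b X ρ) (λ X ρ → ∸-<ᵇ (sem a X ρ) (sem b X ρ))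
  where
  ∸-<ᵇ : ∀ a b → not ((b ∸ a) ≡ᵇ 0) ≡ (a <ᵇ b)
  ∸-<ᵇ zero zero = refl
  ∸-<ᵇ zero (suc b) = refl
  ∸-<ᵇ (suc a) zero = refl
  ∸-<ᵇ (suc a) (suc b) = ∸-<ᵇ a b

triᴾ : Prog Γ nat → Prog Γ nat
triᴾ n = withSem (natrecᴾ n (lit nat 0) (sucᴾ v₀ +ᴾ v₁)) (λ X ρ → tri (sem n X ρ)) (λ X ρ → natrec-tri (sem n X ρ))
  where
  natrec-tri : ∀ x → natrec 0 (λ i r → suc i + r) x ≡ tri x
  natrec-tri zero = refl
  natrec-tri (suc x) = cong (suc x +_) (natrec-tri x)

cpᴾ : Prog Γ nat → Prog Γ nat → Prog Γ nat
cpᴾ = app₂ (triᴾ (v₀ +ᴾ v₁) +ᴾ v₁)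

-- The Cantor pair cp a b lies in the a+b-th diagonal [tri (a+b), tri (a+b+1)),
-- whose index triRoot finds by counting up.
triRoot : ℕ → ℕ
triRoot = natrec 0 (λ i k → if tri (suc k) <ᵇ suc (suc i) then suc k else k)

unpair₂ : ℕ → ℕ
unpair₂ c = c ∸ tri (triRoot c)

unpair₁ : ℕ → ℕ
unpair₁ c = triRoot c ∸ unpair₂ c

triRootᴾ : Prog Γ nat → Prog Γ nat
triRootᴾ n = natrecᴾ n (lit nat 0) (ifᴾ triᴾ (sucᴾ v₁) <ᴾ sucᴾ (sucᴾ v₀) then sucᴾ v₁ else v₁)

unpair₂ᴾ : Prog Γ nat → Prog Γ nat
unpair₂ᴾ = app₁ (v₀ ∸ᴾ triᴾ (triRootᴾ v₀))

unpair₁ᴾ : Prog Γ nat → Prog Γ nat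
unpair₁ᴾ = app₁ (triRootᴾ v₀ ∸ᴾ unpair₂ᴾ v₀)

tri-mono : ∀ {k j} → k ≤ j → tri k ≤ tri j
tri-mono k≤j = upward-closed (λ {j} le → ≤-trans le (m≤n+m (tri j) (suc j))) k≤j ≤-refl

triRoot-bounds : ∀ c → tri (triRoot c) ≤ c × c < tri (suc (triRoot c))
triRoot-bounds zero = z≤n , s≤s z≤n
triRoot-bounds (suc c) with triRoot-bounds c
... | lo , hi with tri (suc (triRoot c)) <ᵇ suc (suc c) | <ᵇ-reflects-< (tri (suc (triRoot c))) (suc (suc c))
...   | true | ofʸ (s≤s t≤c+1) =
  t≤c+1 , subst (_< tri (suc (suc (triRoot c)))) (≤-antisym t≤c+1 hi) (m<n+m (tri (suc (triRoot c))) {suc (suc (triRoot c))} z<s)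
...   | false | ofⁿ t≮c+2 = m≤n⇒m≤1+n lo , ≰⇒> (t≮c+2 ∘ s≤s)

tri-bracket-unique : ∀ {c k j} → tri k ≤ c → c < tri (suc k) → tri j ≤ c → c < tri (suc j) → k ≡ j
tri-bracket-unique {k = k} {j} lo hi lo′ hi′ with <-cmp k j
... | tri< k<j _ _ = contradiction (≤-trans (tri-mono k<j) lo′) (<⇒≱ hi)
... | tri≈ _ k≡j _ = k≡j
... | tri> _ _ j<k = contradiction (≤-trans (tri-mono j<k) lo) (<⇒≱ hi′)

triRoot-cp : ∀ a b → triRoot (cp a b) ≡ a + b
triRoot-cp a b = sym (tri-bracket-unique (m≤m+n (tri (a + b)) b) cp<tri (proj₁ (triRoot-bounds (cp a b))) (proj₂ (triRoot-bounds (cp a b))))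
  where
  cp<tri : tri (a + b) + b < tri (suc (a + b))
  cp<tri = subst (tri (a + b) + b <_) (+-comm (tri (a + b)) (suc (a + b))) (+-monoʳ-< (tri (a + b)) (s≤s (m≤n+m b a)))

unpair₂-cp : ∀ a b → unpair₂ (cp a b) ≡ b
unpair₂-cp a b rewrite triRoot-cp a b = m+n∸m≡n (tri (a + b)) b

unpair₁-cp : ∀ a b → unpair₁ (cp a b) ≡ a
unpair₁-cp a b rewrite unpair₂-cp a b | triRoot-cp a b = m+n∸n≡m a b

-- Pairs, lists and decoding

default : (τ : Ty) → ⟦ τ ⟧
default nat = 0
default bool = false
default fin3 = fz
default (list τ) = []
default (pair σ τ) = default σ , default τ
default (gam zero) = []
default (gam (suc m)) = []

encode-default : ∀ τ → encode τ (default τ) ≡ 0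
encode-default nat = refl
encode-default bool = refl
encode-default fin3 = refl
encode-default (list τ) = refl
encode-default (pair σ τ) rewrite encode-default σ | encode-default τ = refl
encode-default (gam zero) = refl
encode-default (gam (suc m)) = refl

infixr 4 _,ᴾ_
infixr 5 _∷ᴾ_

_,ᴾ_ : Prog Γ σ → Prog Γ τ → Prog Γ (pair σ τ)
a ,ᴾ b = reinterpret (cpᴾ (codeᴾ a) (codeᴾ b)) (λ X ρ → sem a X ρ , sem b X ρ) (λ _ _ → refl)

proj₁ᴾ : Prog Γ (pair σ τ) → Prog Γ σ
proj₁ᴾ {σ = σ} {τ = τ} p = reinterpret (unpair₁ᴾ (codeᴾ p)) (λ X ρ → proj₁ (sem p X ρ))
  (λ X ρ → unpair₁-cp (encode σ (proj₁ (sem p X ρ))) (encode τ (proj₂ (sem p X ρ))))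

proj₂ᴾ : Prog Γ (pair σ τ) → Prog Γ τ
proj₂ᴾ {σ = σ} {τ = τ} p = reinterpret (unpair₂ᴾ (codeᴾ p)) (λ X ρ → proj₂ (sem p X ρ))
  (λ X ρ → unpair₂-cp (encode σ (proj₁ (sem p X ρ))) (encode τ (proj₂ (sem p X ρ))))

[]ᴾ : Prog Γ (list σ)
[]ᴾ {σ = σ} = lit (list σ) []

_∷ᴾ_ : Prog Γ σ → Prog Γ (list σ) → Prog Γ (list σ)
x ∷ᴾ xs = reinterpret (sucᴾ (cpᴾ (codeᴾ x) (codeᴾ xs))) (λ X ρ → sem x X ρ ∷ sem xs X ρ) (λ _ _ → refl)

headOr : {A : Set} → A → List A → A
headOr d [] = d
headOr d (x ∷ xs) = x

drop₁ : {A : Set} → List A → List A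
drop₁ [] = []
drop₁ (x ∷ xs) = xs

headᴾ : Prog Γ (list σ) → Prog Γ σ
headᴾ {σ = σ} l = reinterpret (unpair₁ᴾ (predᴾ (codeᴾ l))) (λ X ρ → headOr (default σ) (sem l X ρ)) (λ X ρ → unpair₁-code (sem l X ρ))
  where
  unpair₁-code : ∀ xs → unpair₁ (pred (encode (list σ) xs)) ≡ encode σ (headOr (default σ) xs)
  unpair₁-code [] = sym (encode-default σ)
  unpair₁-code (x ∷ xs) = unpair₁-cp (encode σ x) (encode (list σ) xs)

drop₁ᴾ : Prog Γ (list σ) → Prog Γ (list σ)
drop₁ᴾ {σ = σ} l = reinterpret (unpair₂ᴾ (predᴾ (codeᴾ l))) (λ X ρ → drop₁ (sem l X ρ)) (λ X ρ → unpair₂-code (sem l X ρ))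
  where
  unpair₂-code : ∀ xs → unpair₂ (pred (encode (list σ) xs)) ≡ encode (list σ) (drop₁ xs)
  unpair₂-code [] = refl
  unpair₂-code (x ∷ xs) = unpair₂-cp (encode σ x) (encode (list σ) xs)

nullᴾ : Prog Γ (list σ) → Prog Γ bool
nullᴾ {σ = σ} l = withSem (isZeroᴾ (codeᴾ l)) (λ X ρ → null (sem l X ρ)) (λ X ρ → isZero-code (sem l X ρ))
  where
  isZero-code : ∀ xs → (encode (list σ) xs ≡ᵇ 0) ≡ null xs
  isZero-code [] = refl
  isZero-code (x ∷ xs) = refl

natrec-const-suc : {A : Set} (s : A) (f : A → A) (N : ℕ) → natrec s (λ _ → f) (suc N) ≡ natrec (f s) (λ _ → f) N
natrec-const-suc s f zero = refl
natrec-const-suc s f (suc N) = cong f (natrec-const-suc s f N)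

natrec-const-fixed : {A : Set} (s : A) (f : A → A) → f s ≡ s → ∀ N → natrec s (λ _ → f) N ≡ s
natrec-const-fixed s f e zero = refl
natrec-const-fixed s f e (suc N) = trans (cong f (natrec-const-fixed s f e N)) e

length≤codeList : {A : Set} (c : A → ℕ) (l : List A) → length l ≤ codeList c l
length≤codeList c [] = z≤n
length≤codeList c (x ∷ xs) = s≤s (≤-trans (length≤codeList c xs) (m≤n+m (codeList c xs) (tri (c x + codeList c xs))))

-- A list is consumed by iterating a step on (rest , accumulator) at least
-- length-many times; its code bounds its length, so that many iterations suffice.
module _ {A B : Set} (d : A) (F : B → A → B) where
  foldlStep : List A × B → List A × B
  foldlStep (xs , acc) = if null xs then (xs , acc) else (drop₁ xs , F acc (headOr d xs))

  natrec-foldlStep : ∀ xs acc N → length xs ≤ N → natrec (xs , acc) (λ _ → foldlStep) N ≡ ([] , foldl F acc xs)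
  natrec-foldlStep [] acc N _ = natrec-const-fixed ([] , acc) foldlStep refl N
  natrec-foldlStep (x ∷ xs) acc (suc N) (s≤s le) =
    trans (natrec-const-suc (x ∷ xs , acc) foldlStep N) (natrec-foldlStep xs (F acc x) N le)

foldlᴾ : Prog Γ (list σ) → Prog Γ τ → Prog (σ ∷ τ ∷ Γ) τ → Prog Γ τ
foldlᴾ {Γ = Γ} {σ = σ} {τ = τ} l z b =
  withSem iteration (λ X ρ → foldl (λ acc x → sem b X (x , acc , ρ)) (sem z X ρ) (sem l X ρ)) iteration-foldl
  where
  step : Prog (nat ∷ pair (list σ) τ ∷ Γ) (pair (list σ) τ)
  step = ifᴾ nullᴾ (proj₁ᴾ v₁) then v₁
         else (drop₁ᴾ (proj₁ᴾ v₁) ,ᴾ subᴾ b (headᴾ (proj₁ᴾ v₁) ∷ₛ proj₂ᴾ v₁ ∷ₛ thin (skip (skip refl⊑))))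
  iteration : Prog Γ τ
  iteration = proj₂ᴾ (natrecᴾ (codeᴾ l) (l ,ᴾ z) step)
  iteration-foldl : ∀ X ρ → sem iteration X ρ ≡ foldl (λ acc x → sem b X (x , acc , ρ)) (sem z X ρ) (sem l X ρ)
  iteration-foldl X ρ = cong proj₂ (natrec-foldlStep (default σ) (λ acc x → sem b X (x , acc , ρ)) (sem l X ρ) (sem z X ρ) _
                                      (length≤codeList (encode σ) (sem l X ρ)))

entry : ℕ → Ty
entry m = pair (list nat) (gam m)

-- G 0 and G (m+1) are, by definition, lists; these change only the type index.
unroll₀ᴾ : Prog Γ (gam zero) → Prog Γ (list (pair nat fin3))
unroll₀ᴾ p = reinterpret p (sem p) (λ _ _ → refl)

unrollᴾ : ∀ {m} → Prog Γ (gam (suc m)) → Prog Γ (list (list (entry m)))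
unrollᴾ p = reinterpret p (sem p) (λ _ _ → refl)

clamp3 : ℕ → Fin 3
clamp3 0 = fz
clamp3 1 = fs fz
clamp3 2 = fs (fs fz)
clamp3 (suc (suc (suc _))) = fz

clamp3ᴾ : Prog Γ nat → Prog Γ fin3
clamp3ᴾ c = reinterpret (ifᴾ (c <ᴾ lit nat 3) then c else lit nat 0) (λ X ρ → clamp3 (sem c X ρ)) (λ X ρ → if<3-clamp3 (sem c X ρ))
  where
  if<3-clamp3 : ∀ c → (if c <ᵇ 3 then c else 0) ≡ toℕ (clamp3 c)
  if<3-clamp3 0 = refl
  if<3-clamp3 1 = refl
  if<3-clamp3 2 = refl
  if<3-clamp3 (suc (suc (suc c))) = refl

record Decoder (τ : Ty) : Set where
  field
    prog : Prog (nat ∷ []) τ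
    decodes : ∀ X v → sem prog X (encode τ v , tt) ≡ v
open Decoder

decodeℕ : Decoder nat
decodeℕ = record { prog = v₀ ; decodes = λ _ _ → refl }

decodeFin3 : Decoder fin3
decodeFin3 = record { prog = clamp3ᴾ v₀ ; decodes = clamp3-toℕ }
  where
  clamp3-toℕ : ∀ X v → clamp3 (toℕ v) ≡ v
  clamp3-toℕ X fz = refl
  clamp3-toℕ X (fs fz) = refl
  clamp3-toℕ X (fs (fs fz)) = refl

decodePair : Decoder σ → Decoder τ → Decoder (pair σ τ)
decodePair {σ = σ} {τ = τ} da db = record
  { prog = app₁ (prog da) (unpair₁ᴾ v₀) ,ᴾ app₁ (prog db) (unpair₂ᴾ v₀)
  ; decodes = λ X (a , b) → cong₂ _,_
      (trans (cong (λ c → sem (prog da) X (c , tt)) (unpair₁-cp (encode σ a) (encode τ b))) (decodes da X a))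
      (trans (cong (λ c → sem (prog db) X (c , tt)) (unpair₂-cp (encode σ a) (encode τ b))) (decodes db X b)) }

-- Peels off the cons cells of a code (head first), then reverses the result.
decodeList : Decoder σ → Decoder (list σ)
decodeList {σ = σ} d = record { prog = reverseᴾ (proj₂ᴾ (natrecᴾ v₀ (v₀ ,ᴾ []ᴾ) peel)) ; decodes = decodes-list }
  where
  reverseᴾ : Prog Γ (list σ) → Prog Γ (list σ)
  reverseᴾ l = foldlᴾ l []ᴾ (v₀ ∷ᴾ v₁)
  peel : Prog (nat ∷ pair nat (list σ) ∷ nat ∷ []) (pair nat (list σ))
  peel = ifᴾ isZeroᴾ (proj₁ᴾ v₁) then v₁
         else (unpair₂ᴾ (predᴾ (proj₁ᴾ v₁)) ,ᴾ app₁ (prog d) (unpair₁ᴾ (predᴾ (proj₁ᴾ v₁))) ∷ᴾ proj₂ᴾ v₁)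
  decodes-list : ∀ X v → sem (reverseᴾ (proj₂ᴾ (natrecᴾ v₀ (v₀ ,ᴾ []ᴾ) peel))) X (encode (list σ) v , tt) ≡ v
  decodes-list X v = trans (cong reverse (cong proj₂ (natrec-peel v [] _ (length≤codeList (encode σ) v)))) (reverse-involutive v)
    where
    peelStep : ℕ × List ⟦ σ ⟧ → ℕ × List ⟦ σ ⟧
    peelStep (c , acc) = if c ≡ᵇ 0 then (c , acc) else (unpair₂ (pred c) , sem (prog d) X (unpair₁ (pred c) , tt) ∷ acc)
    peelStep-cons : ∀ x xs acc → peelStep (encode (list σ) (x ∷ xs) , acc) ≡ (encode (list σ) xs , (x ∷ acc))
    peelStep-cons x xs acc = cong₂ _,_ (unpair₂-cp (encode σ x) (encode (list σ) xs))
      (cong (_∷ acc) (trans (cong (λ c → sem (prog d) X (c , tt)) (unpair₁-cp (encode σ x) (encode (list σ) xs))) (decodes d X x)))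
    natrec-peel : ∀ xs acc N → length xs ≤ N → natrec (encode (list σ) xs , acc) (λ _ → peelStep) N ≡ (0 , foldl (λ a x → x ∷ a) acc xs)
    natrec-peel [] acc N _ = natrec-const-fixed (0 , acc) peelStep refl N
    natrec-peel (x ∷ xs) acc (suc N) (s≤s le) =
      trans (natrec-const-suc _ peelStep N) (trans (cong (λ st → natrec st (λ _ → peelStep) N) (peelStep-cons x xs acc)) (natrec-peel xs (x ∷ acc) N le))

decodeG : (m : ℕ) → Decoder (gam m)
decodeG zero = record { prog = reinterpret (prog d) (sem (prog d)) (λ _ _ → refl) ; decodes = decodes d }
  where
  d : Decoder (list (pair nat fin3))
  d = decodeList (decodePair decodeℕ decodeFin3)
decodeG (suc m) = record { prog = reinterpret (prog d) (sem (prog d)) (λ _ _ → refl) ; decodes = decodes d }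
  where
  d : Decoder (list (list (entry m)))
  d = decodeList (decodeList (decodePair (decodeList decodeℕ) (decodeG m)))

-- Simulating the evaluator

nats : (k : ℕ) → Ctx k
nats zero = []
nats (suc k) = nat ∷ nats k

encodeMaybe : Maybe ℕ → ℕ
encodeMaybe nothing = 0
encodeMaybe (just y) = suc y

record Simulation (Ξ : PR k) : Set where
  field
    simulator : Prog (nat ∷ nats k) nat
    simulates : ∀ X f ρ → sem simulator X (f , ρ) ≡ encodeMaybe (eval f X Ξ (encodeEnv (nats k) ρ))
open Simulation

record SimulationAll (hs : Vec (PR k) l) : Set where
  field
    allDefinedᴾ : Prog (nat ∷ nats k) bool
    allDefined-sem : ∀ X f ρ → sem allDefinedᴾ X (f , ρ) ≡ is-just (evalAll (pred f) X hs (encodeEnv (nats k) ρ))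
    outputsₛ : Sub (nat ∷ nats k) (nats l)
    outputs-sem : ∀ X f ρ ys → evalAll (pred f) X hs (encodeEnv (nats k) ρ) ≡ just ys →
                  encodeEnv (nats l) (semSub outputsₛ X (f , ρ)) ≡ ys
open SimulationAll

natVar : Fin k → nats k ∋ nat
natVar {suc k} fz = here
natVar {suc k} (fs i) = there (natVar i)

toFin-natVar : (i : Fin k) → toFin (natVar i) ≡ i
toFin-natVar {suc k} fz = refl
toFin-natVar {suc k} (fs i) = cong fs (toFin-natVar i)

natrec-cong : {A : Set} (z : A) {s s′ : ℕ → A → A} → (∀ i a → s i a ≡ s′ i a) → ∀ n → natrec z s n ≡ natrec z s′ n
natrec-cong z e zero = refl
natrec-cong z {s′ = s′} e (suc n) = trans (e n _) (cong (s′ n) (natrec-cong z e n))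

firstNonZero : (ℕ → ℕ) → ℕ → ℕ → ℕ
firstNonZero D i = natrec 0 (λ j r → if r ≡ᵇ 0 then D (i + j) else r)

firstNonZero-suc : ∀ D i b → firstNonZero D i (suc b) ≡ (if D i ≡ᵇ 0 then firstNonZero D (suc i) b else D i)
firstNonZero-suc D i zero rewrite +-identityʳ i with D i
... | zero = refl
... | suc _ = refl
firstNonZero-suc D i (suc b) rewrite firstNonZero-suc D i b with D i ≡ᵇ 0 in D≡0
... | true rewrite +-suc i b = refl
... | false rewrite D≡0 = refl

guardFuel : Prog (nat ∷ nats k) nat → Prog (nat ∷ nats k) nat
guardFuel p = ifᴾ isZeroᴾ v₀ then lit nat 0 else p

atPredFuel : Prog (nat ∷ nats k) τ → Prog (nat ∷ nats k) τ
atPredFuel p = subᴾ p (predᴾ v₀ ∷ₛ thin (skip refl⊑))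

mutual
  simulation : (Ξ : PR k) → Simulation Ξ
  simulation zeroF = record { simulator = guardFuel (lit nat 1) ; simulates = λ { X zero ρ → refl ; X (suc f) ρ → refl } }
  simulation succF = record { simulator = guardFuel (sucᴾ (sucᴾ v₁)) ; simulates = λ { X zero ρ → refl ; X (suc f) ρ → refl } }
  simulation (proj i) = record
    { simulator = guardFuel (sucᴾ (var (there (natVar i))))
    ; simulates = λ { X zero ρ → refl
                    ; X (suc f) ρ → cong suc (sym (trans (cong (V.lookup (encodeEnv _ ρ)) (sym (toFin-natVar i))) (lookup-encodeEnv (natVar i) ρ))) } }
  simulation orac = record { simulator = guardFuel (sucᴾ (oracleᴾ v₁)) ; simulates = λ { X zero ρ → refl ; X (suc f) ρ → refl } }
  simulation (comp g hs) = simulation-comp g hs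
  simulation (prec g h) = simulation-prec g h
  simulation (mu g) = simulation-mu g

  simulation-comp : (g : PR l) (hs : Vec (PR k) l) → Simulation (comp g hs)
  simulation-comp {k = k} g hs = record { simulator = P ; simulates = spec }
    where
    S : SimulationAll hs
    S = simulationAll hs
    P : Prog (nat ∷ nats k) nat
    P = guardFuel (ifᴾ allDefinedᴾ S then subᴾ (simulator (simulation g)) (predᴾ v₀ ∷ₛ outputsₛ S) else lit nat 0)
    spec : ∀ X f ρ → sem P X (f , ρ) ≡ encodeMaybe (eval f X (comp g hs) (encodeEnv (nats k) ρ))
    spec X zero ρ = refl
    spec X (suc f) ρ with evalAll f X hs (encodeEnv (nats k) ρ) in eq
    ... | nothing rewrite allDefined-sem S X (suc f) ρ | eq = refl
    ... | just ys rewrite allDefined-sem S X (suc f) ρ | eq =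
      trans (simulates (simulation g) X f (semSub (outputsₛ S) X (suc f , ρ)))
            (cong (λ v → encodeMaybe (eval f X g v)) (outputs-sem S X (suc f) ρ ys eq))

  simulation-prec : (g : PR k) (h : PR (suc (suc k))) → Simulation (prec g h)
  simulation-prec {k = k} g h = record { simulator = P ; simulates = spec }
    where
    step : Prog (nat ∷ nat ∷ nat ∷ nat ∷ nats k) nat
    step = ifᴾ isZeroᴾ v₁ then lit nat 0
           else subᴾ (simulator (simulation h)) (predᴾ v₂ ∷ₛ v₀ ∷ₛ predᴾ v₁ ∷ₛ thin (skip (skip (skip (skip refl⊑)))))
    P : Prog (nat ∷ nats (suc k)) nat
    P = guardFuel (natrecᴾ v₁ (subᴾ (simulator (simulation g)) (predᴾ v₀ ∷ₛ thin (skip (skip refl⊑)))) step)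
    spec : ∀ X f ρ → sem P X (f , ρ) ≡ encodeMaybe (eval f X (prec g h) (encodeEnv (nats (suc k)) ρ))
    spec X zero ρ = refl
    spec X (suc f) (n , ρ) = natrec-evalRec n
      where
      natrec-evalRec : ∀ n → natrec (sem (simulator (simulation g)) X (f , ρ)) (λ i a → sem step X (i , a , suc f , n , ρ)) n
                             ≡ encodeMaybe (evalRec f X g h n (encodeEnv (nats k) ρ))
      natrec-evalRec zero = simulates (simulation g) X f ρ
      natrec-evalRec (suc n) rewrite natrec-evalRec n with evalRec f X g h n (encodeEnv (nats k) ρ)
      ... | nothing = refl
      ... | just r = simulates (simulation h) X f (n , r , ρ)

  -- The search state is 0 while searching, 1 once a candidate diverged, and
  -- suc (suc i) once i was found.
  simulation-mu : (g : PR (suc k)) → Simulation (mu g)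
  simulation-mu {k = k} g = record { simulator = P ; simulates = spec }
    where
    candidate : Prog (nat ∷ nat ∷ nat ∷ nats k) nat
    candidate = subᴾ (simulator (simulation g)) (predᴾ v₂ ∷ₛ v₀ ∷ₛ thin (skip (skip (skip refl⊑))))
    step : Prog (nat ∷ nat ∷ nat ∷ nats k) nat
    step = ifᴾ isZeroᴾ v₁ then (ifᴾ isZeroᴾ candidate then lit nat 1
                                else (ifᴾ isZeroᴾ (predᴾ candidate) then sucᴾ (sucᴾ v₀) else lit nat 0))
           else v₁
    P : Prog (nat ∷ nats k) nat
    P = guardFuel (predᴾ (natrecᴾ (predᴾ v₀) (lit nat 0) step))
    spec : ∀ X f ρ → sem P X (f , ρ) ≡ encodeMaybe (eval f X (mu g) (encodeEnv (nats k) ρ))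
    spec X zero ρ = refl
    spec X (suc f) ρ = trans (cong pred (natrec-cong 0 step-sem f)) (firstNonZero-search f 0)
      where
      xs : Vec ℕ k
      xs = encodeEnv (nats k) ρ
      outcome : ℕ → ℕ
      outcome i = if encodeMaybe (eval f X g (i ∷ xs)) ≡ᵇ 0 then 1
                  else (if pred (encodeMaybe (eval f X g (i ∷ xs))) ≡ᵇ 0 then suc (suc i) else 0)
      step-sem : ∀ j r → sem step X (j , r , suc f , ρ) ≡ (if r ≡ᵇ 0 then outcome (0 + j) else r)
      step-sem j r rewrite simulates (simulation g) X f (j , ρ) = refl
      firstNonZero-search : ∀ b i → pred (firstNonZero outcome i b) ≡ encodeMaybe (search f b X g xs i)
      firstNonZero-search zero i = refl
      firstNonZero-search (suc b) i rewrite firstNonZero-suc outcome i b with eval f X g (i ∷ xs)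
      ... | nothing = refl
      ... | just zero = refl
      ... | just (suc y) = firstNonZero-search b (suc i)

  simulationAll : (hs : Vec (PR k) l) → SimulationAll hs
  simulationAll [] = record
    { allDefinedᴾ = lit bool true ; allDefined-sem = λ _ _ _ → refl
    ; outputsₛ = thin []⊑ ; outputs-sem = λ { X f ρ [] e → refl } }
  simulationAll {k = k} {l = suc l} (h ∷ hs) = record
    { allDefinedᴾ = notᴾ (isZeroᴾ Ph) ∧ᴾ allDefinedᴾ S ; allDefined-sem = defined-sem
    ; outputsₛ = predᴾ Ph ∷ₛ outputsₛ S ; outputs-sem = outputs-sem-∷ }
    where
    S : SimulationAll hs
    S = simulationAll hs
    Ph : Prog (nat ∷ nats k) nat
    Ph = atPredFuel (simulator (simulation h))
    defined-sem : ∀ X f ρ → sem (notᴾ (isZeroᴾ Ph) ∧ᴾ allDefinedᴾ S) X (f , ρ) ≡ is-just (evalAll (pred f) X (h ∷ hs) (encodeEnv (nats k) ρ))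
    defined-sem X f ρ rewrite simulates (simulation h) X (pred f) ρ | allDefined-sem S X f ρ with eval (pred f) X h (encodeEnv (nats k) ρ)
    ... | nothing = refl
    ... | just y with evalAll (pred f) X hs (encodeEnv (nats k) ρ)
    ...   | nothing = refl
    ...   | just ys = refl
    outputs-sem-∷ : ∀ X f ρ ys → evalAll (pred f) X (h ∷ hs) (encodeEnv (nats k) ρ) ≡ just ys →
                    encodeEnv (nats (suc l)) (semSub (predᴾ Ph ∷ₛ outputsₛ S) X (f , ρ)) ≡ ys
    outputs-sem-∷ X f ρ ys e with >>=-just-inv (eval (pred f) X h (encodeEnv (nats k) ρ)) _ e
    ... | y , e₁ , e₂ with >>=-just-inv (evalAll (pred f) X hs (encodeEnv (nats k) ρ)) _ e₂
    ... | ys′ , e₃ , refl rewrite simulates (simulation h) X (pred f) ρ | e₁ = cong (y ∷_) (outputs-sem S X f ρ ys′ e₃)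

-- Boolean deciders

reflects-map : {A B : Set} {b : Bool} → (A → B) → (B → A) → Reflects A b → Reflects B b
reflects-map f g (ofʸ a) = ofʸ (f a)
reflects-map f g (ofⁿ ¬a) = ofⁿ (¬a ∘ g)

if-reflects : ∀ {P Q R : Set} {b c d} → Reflects P b → Reflects Q c → Reflects R d →
  Reflects ((P × Q) ⊎ (¬ P × R)) (if b then c else d)
if-reflects (ofʸ p) q r = reflects-map (λ q → inj₁ (p , q)) [ proj₂ , (λ (¬p , _) → contradiction p ¬p) ]′ q
if-reflects (ofⁿ ¬p) q r = reflects-map (λ r → inj₂ (¬p , r)) [ (λ (p , _) → contradiction p ¬p) , proj₂ ]′ r

≡ᵇ-reflects : ∀ m n → Reflects (m ≡ n) (m ≡ᵇ n)
≡ᵇ-reflects m n = fromEquivalence (≡ᵇ⇒≡ m n) (≡⇒≡ᵇ m n)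

cp-injective : ∀ {a b c d} → cp a b ≡ cp c d → a ≡ c × b ≡ d
cp-injective {a} {b} {c} {d} e =
  trans (sym (unpair₁-cp a b)) (trans (cong unpair₁ e) (unpair₁-cp c d)) ,
  trans (sym (unpair₂-cp a b)) (trans (cong unpair₂ e) (unpair₂-cp c d))

codeList-injective : {A : Set} {c : A → ℕ} → (∀ {x y} → c x ≡ c y → x ≡ y) → ∀ {xs ys} → codeList c xs ≡ codeList c ys → xs ≡ ys
codeList-injective c-inj {[]} {[]} e = refl
codeList-injective c-inj {x ∷ xs} {y ∷ ys} e =
  let x≡y , xs≡ys = cp-injective (suc-injective e) in cong₂ _∷_ (c-inj x≡y) (codeList-injective c-inj xs≡ys)

pair-code-injective : {A B : Set} {ca : A → ℕ} {cb : B → ℕ} → (∀ {x y} → ca x ≡ ca y → x ≡ y) → (∀ {x y} → cb x ≡ cb y → x ≡ y) →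
  ∀ {p q : A × B} → cp (ca (proj₁ p)) (cb (proj₂ p)) ≡ cp (ca (proj₁ q)) (cb (proj₂ q)) → p ≡ q
pair-code-injective ca-inj cb-inj e = let e₁ , e₂ = cp-injective e in cong₂ _,_ (ca-inj e₁) (cb-inj e₂)

code-injective : ∀ m {γ δ : G m} → code m γ ≡ code m δ → γ ≡ δ
code-injective zero = codeList-injective (pair-code-injective id (toℕ-injective))
code-injective (suc m) = codeList-injective (codeList-injective (pair-code-injective (codeList-injective id) (code-injective m)))

bit-injective : ∀ {x y} → bit x ≡ bit y → x ≡ y
bit-injective {false} {false} e = refl
bit-injective {true} {true} e = refl

encode-injective : ∀ τ {x y : ⟦ τ ⟧} → encode τ x ≡ encode τ y → x ≡ y
encode-injective nat e = e
encode-injective bool e = bit-injective e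
encode-injective fin3 e = toℕ-injective e
encode-injective (list τ) e = codeList-injective (encode-injective τ) e
encode-injective (pair σ τ) e = pair-code-injective (encode-injective σ) (encode-injective τ) e
encode-injective (gam m) e = code-injective m e

codeEqᵇ : (τ : Ty) → ⟦ τ ⟧ → ⟦ τ ⟧ → Bool
codeEqᵇ τ x y = encode τ x ≡ᵇ encode τ y

codeEqᵇ-reflects : ∀ τ x y → Reflects (x ≡ y) (codeEqᵇ τ x y)
codeEqᵇ-reflects τ x y = reflects-map (encode-injective τ) (cong (encode τ)) (≡ᵇ-reflects (encode τ x) (encode τ y))

-- Every list traversal below is a foldl, the only list recursion that foldlᴾ provides.
allᵇ : {A : Set} → (A → Bool) → List A → Bool
allᵇ p = foldl (λ acc x → acc ∧ p x) true

allᴾ : Prog Γ (list σ) → Prog (σ ∷ Γ) bool → Prog Γ bool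
allᴾ l p = withSem (foldlᴾ l (lit bool true) (v₁ ∧ᴾ wk₁ᴾ p))
  (λ X ρ → allᵇ (λ x → sem p X (x , ρ)) (sem l X ρ)) (λ _ _ → refl)

foldl-∧ : {A : Set} (p : A → Bool) → ∀ b xs → foldl (λ acc x → acc ∧ p x) b xs ≡ b ∧ allᵇ p xs
foldl-∧ p b [] = sym (∧-identityʳ b)
foldl-∧ p b (x ∷ xs) = begin
  foldl (λ acc x → acc ∧ p x) (b ∧ p x) xs ≡⟨ foldl-∧ p (b ∧ p x) xs ⟩
  (b ∧ p x) ∧ allᵇ p xs                   ≡⟨ ∧-assoc b (p x) (allᵇ p xs) ⟩
  b ∧ (p x ∧ allᵇ p xs)                   ≡⟨ cong (b ∧_) (foldl-∧ p (p x) xs) ⟨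
  b ∧ allᵇ p (x ∷ xs)                  ∎

allᵇ-reflects : {A : Set} {P : A → Set} {p : A → Bool} → (∀ x → Reflects (P x) (p x)) → ∀ xs → Reflects (All P xs) (allᵇ p xs)
allᵇ-reflects r [] = ofʸ []
allᵇ-reflects {p = p} r (x ∷ xs) = subst (Reflects _) (sym (foldl-∧ p (p x) xs))
  (reflects-map (λ (px , pxs) → px ∷ pxs) (λ { (px ∷ pxs) → px , pxs }) (r x ×-reflects allᵇ-reflects r xs))

anyᵇ : {A : Set} → (A → Bool) → List A → Bool
anyᵇ p = foldl (λ acc x → acc ∨ p x) false

anyᴾ : Prog Γ (list σ) → Prog (σ ∷ Γ) bool → Prog Γ bool
anyᴾ l p = withSem (foldlᴾ l (lit bool false) (v₁ ∨ᴾ wk₁ᴾ p))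
  (λ X ρ → anyᵇ (λ x → sem p X (x , ρ)) (sem l X ρ)) (λ _ _ → refl)

foldl-∨ : {A : Set} (p : A → Bool) → ∀ b xs → foldl (λ acc x → acc ∨ p x) b xs ≡ b ∨ anyᵇ p xs
foldl-∨ p b [] = sym (∨-identityʳ b)
foldl-∨ p b (x ∷ xs) = begin
  foldl (λ acc x → acc ∨ p x) (b ∨ p x) xs ≡⟨ foldl-∨ p (b ∨ p x) xs ⟩
  (b ∨ p x) ∨ anyᵇ p xs                   ≡⟨ ∨-assoc b (p x) (anyᵇ p xs) ⟩
  b ∨ (p x ∨ anyᵇ p xs)                   ≡⟨ cong (b ∨_) (foldl-∨ p (p x) xs) ⟨
  b ∨ anyᵇ p (x ∷ xs)                  ∎

anyᵇ-reflects : {A : Set} {P : A → Set} {p : A → Bool} → (∀ x → Reflects (P x) (p x)) → ∀ xs → Reflects (Any P xs) (anyᵇ p xs)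
anyᵇ-reflects r [] = ofⁿ λ ()
anyᵇ-reflects {p = p} r (x ∷ xs) = subst (Reflects _) (sym (foldl-∨ p (p x) xs))
  (reflects-map (λ { (inj₁ px) → here px ; (inj₂ pxs) → there pxs }) (λ { (here px) → inj₁ px ; (there pxs) → inj₂ pxs })
                (r x ⊎-reflects anyᵇ-reflects r xs))

-- The accumulator holds the previous element, as a list of length at most one.
linkedStep : {A : Set} → A → (A → A → Bool) → Bool × List A → A → Bool × List A
linkedStep d R (ok , prev) x = (ok ∧ (null prev ∨ R (headOr d prev) x)) , [ x ]

linkedᵇ : {A : Set} → A → (A → A → Bool) → List A → Bool
linkedᵇ d R xs = proj₁ (foldl (linkedStep d R) (true , []) xs)

linkedᴾ : Prog Γ (list σ) → Prog (σ ∷ σ ∷ Γ) bool → Prog Γ bool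
linkedᴾ {Γ = Γ} {σ = σ} l R = withSem (proj₁ᴾ (foldlᴾ l (lit bool true ,ᴾ []ᴾ) step))
  (λ X ρ → linkedᵇ (default σ) (λ a b → sem R X (a , b , ρ)) (sem l X ρ)) (λ _ _ → refl)
  where
  step : Prog (σ ∷ pair bool (list σ) ∷ Γ) (pair bool (list σ))
  step = (proj₁ᴾ v₁ ∧ᴾ (nullᴾ (proj₂ᴾ v₁) ∨ᴾ subᴾ R (headᴾ (proj₂ᴾ v₁) ∷ₛ v₀ ∷ₛ thin (skip (skip refl⊑)))))
         ,ᴾ v₀ ∷ᴾ []ᴾ

linkedFromᵇ : {A : Set} → (A → A → Bool) → A → List A → Bool
linkedFromᵇ R x [] = true
linkedFromᵇ R x (y ∷ ys) = R x y ∧ linkedFromᵇ R y ys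

foldl-linkedStep : {A : Set} (d : A) (R : A → A → Bool) → ∀ b x xs →
  proj₁ (foldl (linkedStep d R) (b , [ x ]) xs) ≡ b ∧ linkedFromᵇ R x xs
foldl-linkedStep d R b x [] = sym (∧-identityʳ b)
foldl-linkedStep d R b x (y ∷ ys) =
  trans (foldl-linkedStep d R (b ∧ R x y) y ys) (∧-assoc b (R x y) (linkedFromᵇ R y ys))

linkedFromᵇ-reflects : {A : Set} {P : A → A → Set} {R : A → A → Bool} → (∀ x y → Reflects (P x y) (R x y)) →
  ∀ x ys → Reflects (Linked P (x ∷ ys)) (linkedFromᵇ R x ys)
linkedFromᵇ-reflects r x [] = ofʸ [-]
linkedFromᵇ-reflects r x (y ∷ ys) =
  reflects-map (λ (pxy , rest) → pxy ∷ rest) (λ { (pxy ∷ rest) → pxy , rest }) (r x y ×-reflects linkedFromᵇ-reflects r y ys)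

linkedᵇ-reflects : {A : Set} (d : A) {P : A → A → Set} {R : A → A → Bool} → (∀ x y → Reflects (P x y) (R x y)) →
  ∀ xs → Reflects (Linked P xs) (linkedᵇ d R xs)
linkedᵇ-reflects d r [] = ofʸ []
linkedᵇ-reflects d {R = R} r (x ∷ xs) = subst (Reflects _) (sym (foldl-linkedStep d R true x xs)) (linkedFromᵇ-reflects r x xs)

-- The accumulator holds the unmatched rest of the candidate extension.
prefixStep : {A : Set} → A → (A → A → Bool) → List A × Bool → A → List A × Bool
prefixStep d eq (rest , ok) x = drop₁ rest , (ok ∧ not (null rest)) ∧ eq (headOr d rest) x

isPrefixᵇ : {A : Set} → A → (A → A → Bool) → List A → List A → Bool
isPrefixᵇ d eq xs ys = proj₂ (foldl (prefixStep d eq) (ys , true) xs)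

isPrefixᴾ : Prog Γ (list σ) → Prog Γ (list σ) → Prog Γ bool
isPrefixᴾ {Γ = Γ} {σ = σ} a b = withSem (proj₂ᴾ (foldlᴾ a (b ,ᴾ lit bool true) step))
  (λ X ρ → isPrefixᵇ (default σ) (codeEqᵇ σ) (sem a X ρ) (sem b X ρ)) (λ _ _ → refl)
  where
  step : Prog (σ ∷ pair (list σ) bool ∷ Γ) (pair (list σ) bool)
  step = drop₁ᴾ (proj₁ᴾ v₁) ,ᴾ ((proj₂ᴾ v₁ ∧ᴾ notᴾ (nullᴾ (proj₁ᴾ v₁))) ∧ᴾ (headᴾ (proj₁ᴾ v₁) ==ᴾ v₀))

foldl-prefixStep-false : {A : Set} (d : A) (eq : A → A → Bool) → ∀ rest xs → proj₂ (foldl (prefixStep d eq) (rest , false) xs) ≡ false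
foldl-prefixStep-false d eq rest [] = refl
foldl-prefixStep-false d eq rest (x ∷ xs) = foldl-prefixStep-false d eq (drop₁ rest) xs

isPrefixᵇ-reflects : {A : Set} (d : A) {eq : A → A → Bool} → (∀ x y → Reflects (x ≡ y) (eq x y)) →
  ∀ xs ys → Reflects (∃ λ zs → xs ++ zs ≡ ys) (isPrefixᵇ d eq xs ys)
isPrefixᵇ-reflects d r [] ys = ofʸ (ys , refl)
isPrefixᵇ-reflects d {eq} r (x ∷ xs) []
  rewrite foldl-prefixStep-false d eq [] xs = ofⁿ λ ()
isPrefixᵇ-reflects d {eq} r (x ∷ xs) (y ∷ ys) with eq y x | r y x
... | true | ofʸ refl = reflects-map (λ (zs , e) → zs , cong (x ∷_) e) (λ (zs , e) → zs , ∷-injectiveʳ e) (isPrefixᵇ-reflects d r xs ys)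
... | false | ofⁿ y≢x rewrite foldl-prefixStep-false d eq ys xs = ofⁿ λ (zs , e) → y≢x (sym (∷-injectiveˡ e))

-- Status 0: undecided so far, 1: less, 2: not less.
lexStep : List ℕ × ℕ → ℕ → List ℕ × ℕ
lexStep (rest , status) x =
  if status ≡ᵇ 0
  then (if null rest then (rest , 2)
        else (if x <ᵇ headOr 0 rest then (rest , 1)
              else (if headOr 0 rest <ᵇ x then (rest , 2) else (drop₁ rest , 0))))
  else (rest , status)

lexFinal : List ℕ × ℕ → Bool
lexFinal (rest , status) = (status ≡ᵇ 1) ∨ ((status ≡ᵇ 0) ∧ not (null rest))

lexᵇ : List ℕ → List ℕ → Bool
lexᵇ a b = lexFinal (foldl lexStep (b , 0) a)

lexᴾ : Prog Γ (list nat) → Prog Γ (list nat) → Prog Γ bool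
lexᴾ {Γ = Γ} a b = withSem (letᴾ (foldlᴾ a (b ,ᴾ lit nat 0) step) final) (λ X ρ → lexᵇ (sem a X ρ) (sem b X ρ)) (λ _ _ → refl)
  where
  st : Prog (nat ∷ pair (list nat) nat ∷ Γ) (pair (list nat) nat)
  st = v₁
  step : Prog (nat ∷ pair (list nat) nat ∷ Γ) (pair (list nat) nat)
  step = ifᴾ (proj₂ᴾ st ==ᴾ lit nat 0)
         then (ifᴾ nullᴾ (proj₁ᴾ st) then (proj₁ᴾ st ,ᴾ lit nat 2)
               else (ifᴾ (v₀ <ᴾ headᴾ (proj₁ᴾ st)) then (proj₁ᴾ st ,ᴾ lit nat 1)
                     else (ifᴾ (headᴾ (proj₁ᴾ st) <ᴾ v₀) then (proj₁ᴾ st ,ᴾ lit nat 2) else (drop₁ᴾ (proj₁ᴾ st) ,ᴾ lit nat 0))))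
         else st
  final : Prog (pair (list nat) nat ∷ Γ) bool
  final = (proj₂ᴾ v₀ ==ᴾ lit nat 1) ∨ᴾ ((proj₂ᴾ v₀ ==ᴾ lit nat 0) ∧ᴾ notᴾ (nullᴾ (proj₁ᴾ v₀)))

foldl-lexStep-decided : ∀ rest k xs → foldl lexStep (rest , suc k) xs ≡ (rest , suc k)
foldl-lexStep-decided rest k [] = refl
foldl-lexStep-decided rest k (x ∷ xs) = foldl-lexStep-decided rest k xs

lexᵇ-reflects : ∀ xs ys → Reflects (xs <ᴸ ys) (lexᵇ xs ys)
lexᵇ-reflects [] [] = ofⁿ λ ()
lexᵇ-reflects [] (y ∷ ys) = ofʸ []<∷
lexᵇ-reflects (x ∷ xs) [] rewrite foldl-lexStep-decided [] 1 xs = ofⁿ λ ()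
lexᵇ-reflects (x ∷ xs) (y ∷ ys) with x <ᵇ y | <ᵇ-reflects-< x y
... | true | ofʸ x<y rewrite foldl-lexStep-decided (y ∷ ys) 0 xs = ofʸ (head< x<y)
... | false | ofⁿ x≮y with y <ᵇ x | <ᵇ-reflects-< y x
...   | true | ofʸ y<x rewrite foldl-lexStep-decided (y ∷ ys) 1 xs =
  ofⁿ λ { (head< x<y) → x≮y x<y ; (tail< _) → <-irrefl refl y<x }
...   | false | ofⁿ y≮x with ≤-antisym (≮⇒≥ y≮x) (≮⇒≥ x≮y)
...     | refl = reflects-map tail< (λ { (head< x<x) → contradiction x<x x≮y ; (tail< t) → t }) (lexᵇ-reflects xs ys)

lengthᵇ : {A : Set} → List A → ℕ
lengthᵇ = foldl (λ k _ → suc k) 0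

lengthᴾ : Prog Γ (list σ) → Prog Γ nat
lengthᴾ l = withSem (foldlᴾ l (lit nat 0) (sucᴾ v₁)) (λ X ρ → lengthᵇ (sem l X ρ)) (λ _ _ → refl)

lengthᵇ≡length : {A : Set} (xs : List A) → lengthᵇ xs ≡ length xs
lengthᵇ≡length = go 0
  where
  go : ∀ {A : Set} k (xs : List A) → foldl (λ k _ → suc k) k xs ≡ k + length xs
  go k [] = sym (+-identityʳ k)
  go k (x ∷ xs) = trans (go (suc k) xs) (sym (+-suc k (length xs)))

lengthᵇ-≡ᵇ-reflects : {A : Set} (xs : List A) → ∀ i → Reflects (length xs ≡ i) (lengthᵇ xs ≡ᵇ i)
lengthᵇ-≡ᵇ-reflects xs i = subst (λ k → Reflects (k ≡ i) (lengthᵇ xs ≡ᵇ i)) (lengthᵇ≡length xs) (≡ᵇ-reflects (lengthᵇ xs) i)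

allBelowᵇ : ℕ → (ℕ → Bool) → Bool
allBelowᵇ k p = natrec true (λ i acc → acc ∧ p i) k

allBelowᴾ : Prog Γ nat → Prog (nat ∷ Γ) bool → Prog Γ bool
allBelowᴾ k p = withSem (natrecᴾ k (lit bool true) (v₁ ∧ᴾ wk₁ᴾ p))
  (λ X ρ → allBelowᵇ (sem k X ρ) (λ i → sem p X (i , ρ))) (λ _ _ → refl)

allBelowᵇ-reflects : {P : ℕ → Set} {p : ℕ → Bool} → (∀ i → Reflects (P i) (p i)) → ∀ k → Reflects (∀ i → i < k → P i) (allBelowᵇ k p)
allBelowᵇ-reflects r zero = ofʸ λ _ ()
allBelowᵇ-reflects r (suc k) =
  reflects-map (λ (below , at) i i<1+k → [ below i , (λ { refl → at }) ]′ (m≤n⇒m<n∨m≡n (s≤s⁻¹ i<1+k)))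
               (λ all → (λ i i<k → all i (m≤n⇒m≤1+n i<k)) , all k ≤-refl)
               (allBelowᵇ-reflects r k ×-reflects r k)

lastᵇ : {A : Set} → A → List A → A
lastᵇ d = foldl (λ _ x → x) d

lastᴾ : Prog Γ (list σ) → Prog Γ σ
lastᴾ {σ = σ} l = withSem (foldlᴾ l (lit σ (default σ)) v₀) (λ X ρ → lastᵇ (default σ) (sem l X ρ)) (λ _ _ → refl)

lastᵇ-∷ʳ : {A : Set} (d : A) → ∀ xs x → lastᵇ d (xs ++ [ x ]) ≡ x
lastᵇ-∷ʳ d [] x = refl
lastᵇ-∷ʳ d (y ∷ xs) x = lastᵇ-∷ʳ y xs x

lastᵇ-split : {A : Set} (d : A) → ∀ xs → xs ≢ [] → ∃ λ ys → ys ++ [ lastᵇ d xs ] ≡ xs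
lastᵇ-split d [] xs≢[] = contradiction refl xs≢[]
lastᵇ-split d (y ∷ []) _ = [] , refl
lastᵇ-split d (y ∷ (z ∷ xs)) _ = let ys , e = lastᵇ-split y (z ∷ xs) (λ ()) in (y ∷ ys) , cong (y ∷_) e

-- Deciding the predicates defining Γ_m

IsChild : Node → Node → Set
IsChild ξ η = ∃ λ n → η ≡ ξ ++ [ n ]

length-prefix : ∀ (ξ ρ : Node) {η} → ξ ++ ρ ≡ η → length η ≡ length ξ + length ρ
length-prefix ξ ρ refl = length-++ ξ

prefix-length-unique : ∀ {ξ ξ′ ρ ρ′ η : Node} → ξ ++ ρ ≡ η → ξ′ ++ ρ′ ≡ η → length ξ ≡ length ξ′ → ξ ≡ ξ′
prefix-length-unique {[]} {[]} _ _ _ = refl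
prefix-length-unique {x ∷ ξ} {x′ ∷ ξ′} {η = y ∷ η} e e′ l =
  cong₂ _∷_ (trans (∷-injectiveˡ e) (sym (∷-injectiveˡ e′))) (prefix-length-unique (∷-injectiveʳ e) (∷-injectiveʳ e′) (suc-injective l))

prefix-of-length : ∀ {i} (η : Node) → i ≤ length η → ∃ λ ξ → IsPrefix ξ η × length ξ ≡ i
prefix-of-length {i} η i≤ = L.take i η , (L.drop i η , take++drop≡id i η) , trans (length-take i η) (m≤n⇒m⊓n≡m i≤)

prefixᵇ : Node → Node → Bool
prefixᵇ = isPrefixᵇ 0 (codeEqᵇ nat)

prefixᵇ-reflects : ∀ ξ η → Reflects (IsPrefix ξ η) (prefixᵇ ξ η)
prefixᵇ-reflects = isPrefixᵇ-reflects 0 (codeEqᵇ-reflects nat)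

strictExtᵇ : Node → Node → Bool
strictExtᵇ ξ η = prefixᵇ ξ η ∧ (lengthᵇ ξ <ᵇ lengthᵇ η)

strictExtᵇ-reflects : ∀ ξ η → Reflects (StrictExt ξ η) (strictExtᵇ ξ η)
strictExtᵇ-reflects ξ η = reflects-map to from (prefixᵇ-reflects ξ η ×-reflects length<)
  where
  length< : Reflects (length ξ < length η) (lengthᵇ ξ <ᵇ lengthᵇ η)
  length< = subst₂ (λ a b → Reflects (a < b) (lengthᵇ ξ <ᵇ lengthᵇ η)) (lengthᵇ≡length ξ) (lengthᵇ≡length η) (<ᵇ-reflects-< _ _)
  to : IsPrefix ξ η × length ξ < length η → StrictExt ξ η
  to (([] , e) , lt) = contradiction (subst (length ξ <_) (trans (length-prefix ξ [] e) (+-identityʳ (length ξ))) lt) (<-irrefl refl)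
  to ((k ∷ ρ , e) , _) = k , ρ , e
  from : StrictExt ξ η → IsPrefix ξ η × length ξ < length η
  from (k , ρ , e) = (k ∷ ρ , e) , subst (length ξ <_) (sym (length-prefix ξ (k ∷ ρ) e)) (m<m+n (length ξ) z<s)

childᵇ : Node → Node → Bool
childᵇ ξ η = prefixᵇ ξ η ∧ (suc (lengthᵇ ξ) ≡ᵇ lengthᵇ η)

childᵇ-reflects : ∀ ξ η → Reflects (IsChild ξ η) (childᵇ ξ η)
childᵇ-reflects ξ η = reflects-map to from (prefixᵇ-reflects ξ η ×-reflects length≡)
  where
  length≡ : Reflects (suc (length ξ) ≡ length η) (suc (lengthᵇ ξ) ≡ᵇ lengthᵇ η)
  length≡ = subst₂ (λ a b → Reflects (suc a ≡ b) (suc (lengthᵇ ξ) ≡ᵇ lengthᵇ η)) (lengthᵇ≡length ξ) (lengthᵇ≡length η) (≡ᵇ-reflects _ _)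
  singleton : ∀ (ρ : Node) → 1 ≡ length ρ → ∃ λ n → ρ ≡ [ n ]
  singleton (n ∷ []) _ = n , refl
  to : IsPrefix ξ η × suc (length ξ) ≡ length η → IsChild ξ η
  to ((ρ , e) , l) =
    let n , ρ≡[n] = singleton ρ (+-cancelˡ-≡ (length ξ) 1 (length ρ) (trans (+-comm (length ξ) 1) (trans l (length-prefix ξ ρ e))))
    in n , trans (sym e) (cong (ξ ++_) ρ≡[n])
  from : IsChild ξ η → IsPrefix ξ η × suc (length ξ) ≡ length η
  from (n , e) = ([ n ] , sym e) , trans (+-comm 1 (length ξ)) (sym (length-prefix ξ [ n ] (sym e)))

module _ {m : ℕ} where
  ∈⇒∈ᵀ : {ξ : Node} {v : G m} {T : Step m} → (ξ , v) ∈ T → ξ ∈ᵀ T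
  ∈⇒∈ᵀ = Any.map (λ e → cong proj₁ (sym e))

  ∈ᵀ⇒∈ : {ξ : Node} {T : Step m} → ξ ∈ᵀ T → ∃ λ v → (ξ , v) ∈ T
  ∈ᵀ⇒∈ (here refl) = _ , here refl
  ∈ᵀ⇒∈ (there i) = let v , j = ∈ᵀ⇒∈ i in v , there j

  All-∈ᵀ : {P : Node → Set} {T : Step m} → All (P ∘ proj₁) T → ∀ {η} → η ∈ᵀ T → P η
  All-∈ᵀ (px ∷ _) (here refl) = px
  All-∈ᵀ (_ ∷ pxs) (there i) = All-∈ᵀ pxs i

  ∈ᵀ-All : {P : Node → Set} {T : Step m} → (∀ {η} → η ∈ᵀ T → P η) → All (P ∘ proj₁) T
  ∈ᵀ-All {T = []} f = []
  ∈ᵀ-All {T = p ∷ T} f = f (here refl) ∷ ∈ᵀ-All (f ∘ there)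

  _∈ᵀᵇ_ : Node → Step m → Bool
  ξ ∈ᵀᵇ T = anyᵇ (λ p → codeEqᵇ (list nat) (proj₁ p) ξ) T

  ∈ᵀᵇ-reflects : ∀ ξ T → Reflects (ξ ∈ᵀ T) (ξ ∈ᵀᵇ T)
  ∈ᵀᵇ-reflects ξ T = anyᵇ-reflects (λ p → codeEqᵇ-reflects (list nat) (proj₁ p) ξ) T

  isLeafᵇ : Node → Step m → Bool
  isLeafᵇ ξ T = allᵇ (λ q → not (strictExtᵇ ξ (proj₁ q))) T

  isLeafᵇ-reflects : ∀ ξ T → Reflects (IsLeaf ξ T) (isLeafᵇ ξ T)
  isLeafᵇ-reflects ξ T = reflects-map (λ a η ext η∈T → All-∈ᵀ a η∈T ext) (λ leaf → ∈ᵀ-All λ η∈T ext → leaf _ ext η∈T)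
    (allᵇ-reflects (λ q → ¬-reflects (strictExtᵇ-reflects ξ (proj₁ q))) T)

  PrefixClosed : Step m → Set
  PrefixClosed T = ∀ ξ η → IsPrefix ξ η → η ∈ᵀ T → ξ ∈ᵀ T

  -- A tree is prefix closed iff each of its nodes has a prefix in it of every length up to its own.
  prefixClosedᵇ : Step m → Bool
  prefixClosedᵇ T =
    allᵇ (λ q → allBelowᵇ (suc (lengthᵇ (proj₁ q))) (λ i → anyᵇ (λ p → prefixᵇ (proj₁ p) (proj₁ q) ∧ (lengthᵇ (proj₁ p) ≡ᵇ i)) T)) T

  prefixClosedᵇ-reflects : ∀ T → Reflects (PrefixClosed T) (prefixClosedᵇ T)
  prefixClosedᵇ-reflects T = reflects-map to from (allᵇ-reflects allPrefixes T)
    where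
    HasPrefixes : Node → Set
    HasPrefixes η = ∀ i → i < suc (length η) → Any (λ p → IsPrefix (proj₁ p) η × length (proj₁ p) ≡ i) T
    allPrefixes : ∀ q → Reflects (HasPrefixes (proj₁ q))
      (allBelowᵇ (suc (lengthᵇ (proj₁ q))) (λ i → anyᵇ (λ p → prefixᵇ (proj₁ p) (proj₁ q) ∧ (lengthᵇ (proj₁ p) ≡ᵇ i)) T))
    allPrefixes (η , _) =
      subst (λ k → Reflects (∀ i → i < suc k → Any (λ p → IsPrefix (proj₁ p) η × length (proj₁ p) ≡ i) T)
                            (allBelowᵇ (suc (lengthᵇ η)) (λ i → anyᵇ (λ p → prefixᵇ (proj₁ p) η ∧ (lengthᵇ (proj₁ p) ≡ᵇ i)) T)))
            (lengthᵇ≡length η)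
            (allBelowᵇ-reflects (λ i → anyᵇ-reflects (λ p → prefixᵇ-reflects (proj₁ p) η ×-reflects lengthᵇ-≡ᵇ-reflects (proj₁ p) i) T)
                                (suc (lengthᵇ η)))
    to : All (HasPrefixes ∘ proj₁) T → PrefixClosed T
    to a ξ η (ρ , e) η∈T =
      let p , p∈T , (ρ′ , e′) , l = find (All-∈ᵀ a η∈T (length ξ) (s≤s (subst (length ξ ≤_) (sym (length-prefix ξ ρ e)) (m≤m+n _ _))))
      in subst (_∈ᵀ T) (prefix-length-unique e′ e l) (∈⇒∈ᵀ p∈T)
    from : PrefixClosed T → All (HasPrefixes ∘ proj₁) T
    from pc = ∈ᵀ-All λ {η} η∈T i i<1+|η| →
      let ξ , ξ≼η , l = prefix-of-length η (s≤s⁻¹ i<1+|η|)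
          v , ξv∈T = ∈ᵀ⇒∈ (pc ξ η ξ≼η η∈T)
      in lose ξv∈T (ξ≼η , l)

  hasRootᵇ : Step m → Bool
  hasRootᵇ T = anyᵇ (codeEqᵇ (entry m) ([] , ζ m)) T

  hasRootᵇ-reflects : ∀ T → Reflects (([] , ζ m) ∈ T) (hasRootᵇ T)
  hasRootᵇ-reflects T = anyᵇ-reflects (codeEqᵇ-reflects (entry m) ([] , ζ m)) T

  sortedᵇ : Step m → Bool
  sortedᵇ T = linkedᵇ (default (entry m)) (λ p q → lexᵇ (proj₁ p) (proj₁ q)) T

  sortedᵇ-reflects : ∀ T → Reflects (Linked (λ p q → proj₁ p <ᴸ proj₁ q) T) (sortedᵇ T)
  sortedᵇ-reflects T = linkedᵇ-reflects (default (entry m)) (λ p q → lexᵇ-reflects (proj₁ p) (proj₁ q)) T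

  Monotone : Step m → Set
  Monotone T = ∀ ξ η v w → (ξ , v) ∈ T → (η , w) ∈ T → IsPrefix ξ η → Le m v w

  monotoneᵇ : (G m → G m → Bool) → Step m → Bool
  monotoneᵇ le T = allᵇ (λ p → allᵇ (λ q → not (prefixᵇ (proj₁ p) (proj₁ q)) ∨ le (proj₂ p) (proj₂ q)) T) T

  monotoneᵇ-reflects : {le : G m → G m → Bool} → (∀ v w → Reflects (Le m v w) (le v w)) → ∀ T → Reflects (Monotone T) (monotoneᵇ le T)
  monotoneᵇ-reflects le-r T =
    reflects-map (λ a ξ η v w i j → All.lookup (All.lookup a i) j) (λ mono → All.tabulate λ i → All.tabulate λ j → mono _ _ _ _ i j)
      (allᵇ-reflects (λ p → allᵇ-reflects (λ q → prefixᵇ-reflects (proj₁ p) (proj₁ q) →-reflects le-r (proj₂ p) (proj₂ q)) T) T)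

  validStepᵇ : (G m → Bool) → (G m → G m → Bool) → Step m → Bool
  validStepᵇ valid le T = sortedᵇ T ∧ (prefixClosedᵇ T ∧ (allᵇ (valid ∘ proj₂) T ∧ (hasRootᵇ T ∧ monotoneᵇ le T)))

  validStepᵇ-reflects : {valid : G m → Bool} {le : G m → G m → Bool} →
    (∀ v → Reflects (Valid m v) (valid v)) → (∀ v w → Reflects (Le m v w) (le v w)) →
    ∀ T → Reflects (ValidStep m T) (validStepᵇ valid le T)
  validStepᵇ-reflects valid-r le-r T =
    sortedᵇ-reflects T ×-reflects (prefixClosedᵇ-reflects T ×-reflects (allᵇ-reflects (valid-r ∘ proj₂) T ×-reflects
      (hasRootᵇ-reflects T ×-reflects monotoneᵇ-reflects le-r T)))

  agreeᵇ : Step m → Step m → Bool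
  agreeᵇ T T′ = allᵇ (λ p → allᵇ (λ q → not (codeEqᵇ (list nat) (proj₁ p) (proj₁ q)) ∨ codeEqᵇ (gam m) (proj₂ p) (proj₂ q)) T′) T

  agreeᵇ-reflects : ∀ T T′ → Reflects (Agree T T′) (agreeᵇ T T′)
  agreeᵇ-reflects T T′ =
    reflects-map (λ a ξ v w i j → All.lookup (All.lookup a i) j refl) (λ ag → All.tabulate λ i → All.tabulate λ { j refl → ag _ _ _ i j })
      (allᵇ-reflects (λ p → allᵇ-reflects (λ q →
        codeEqᵇ-reflects (list nat) (proj₁ p) (proj₁ q) →-reflects codeEqᵇ-reflects (gam m) (proj₂ p) (proj₂ q)) T′) T)

module _ {m : ℕ} where
  -- The witness F of a one-step variation can be read off T′: the labels of the children of ξ in T′.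
  childLabels : Node → Step m → List ℕ
  childLabels ξ [] = []
  childLabels ξ ((η , _) ∷ T) = if childᵇ ξ η then lastᵇ 0 η ∷ childLabels ξ T else childLabels ξ T

  childLabels-sound : ∀ ξ T {n} → n ∈ childLabels ξ T → (ξ ++ [ n ]) ∈ᵀ T
  childLabels-sound ξ ((η , _) ∷ T) n∈ with childᵇ ξ η | childᵇ-reflects ξ η
  childLabels-sound ξ ((_ , _) ∷ T) (here refl) | true | ofʸ (n , refl) = here (cong (ξ ++_) (cong [_] (sym (lastᵇ-∷ʳ 0 ξ n))))
  childLabels-sound ξ ((_ , _) ∷ T) (there n∈) | true | ofʸ _ = there (childLabels-sound ξ T n∈)
  ... | false | ofⁿ _ = there (childLabels-sound ξ T n∈)

  childLabels-complete : ∀ ξ T {n} → (ξ ++ [ n ]) ∈ᵀ T → n ∈ childLabels ξ T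
  childLabels-complete ξ ((η , _) ∷ T) {n} i with childᵇ ξ η | childᵇ-reflects ξ η | i
  ... | true | ofʸ _ | here e = here (sym (trans (cong (lastᵇ 0) e) (lastᵇ-∷ʳ 0 ξ n)))
  ... | true | ofʸ _ | there i′ = there (childLabels-complete ξ T i′)
  ... | false | ofⁿ ¬child | here e = contradiction (n , e) ¬child
  ... | false | ofⁿ _ | there i′ = childLabels-complete ξ T i′

  childLabels-child : ∀ ξ T {η} → IsChild ξ η → η ∈ᵀ T → ∃ λ n → n ∈ childLabels ξ T × η ≡ ξ ++ [ n ]
  childLabels-child ξ T (n , refl) η∈T = n , childLabels-complete ξ T η∈T , refl

  -- OneStep with the witness F eliminated.
  LeafCase : Node → Step m → Step m → Set
  LeafCase ξ T T′ = All (λ q → proj₁ q ∈ᵀ T′) T × All (λ q → proj₁ q ∈ᵀ T ⊎ IsChild ξ (proj₁ q)) T′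

  NonLeafCase : Node → Step m → Step m → Set
  NonLeafCase ξ T T′ =
    All (λ q → StrictExt ξ (proj₁ q) ⊎ proj₁ q ∈ᵀ T′) T ×
    All (λ q → (proj₁ q ∈ᵀ T × ¬ StrictExt ξ (proj₁ q)) ⊎ (IsChild ξ (proj₁ q) × proj₁ q ∈ᵀ T)) T′ ×
    Any (λ q → IsChild ξ (proj₁ q) × ¬ (proj₁ q ∈ᵀ T′)) T

  CaseAt : Node → Step m → Step m → Set
  CaseAt ξ T T′ = (IsLeaf ξ T × LeafCase ξ T T′) ⊎ (¬ IsLeaf ξ T × NonLeafCase ξ T T′)

  OneStepAt : Node → Step m → Step m → Set
  OneStepAt ξ T T′ = Any (IsChild ξ ∘ proj₁) T′ × CaseAt ξ T T′

  VariationAt : Node → List ℕ → Step m → Step m → Set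
  VariationAt ξ F T T′ =
    (IsLeaf ξ T × (∀ η → η ∈ᵀ T′ ⇔ (η ∈ᵀ T ⊎ ∃ λ n → n ∈ F × η ≡ ξ ++ [ n ]))) ⊎
    (¬ IsLeaf ξ T ×
      (∀ η → η ∈ᵀ T′ ⇔ ((η ∈ᵀ T × ¬ StrictExt ξ η) ⊎ ∃ λ n → n ∈ F × η ≡ ξ ++ [ n ])) ×
      (∀ n → n ∈ F → (ξ ++ [ n ]) ∈ᵀ T) ×
      (∃ λ n → (ξ ++ [ n ]) ∈ᵀ T × ¬ (n ∈ F)))

  caseAt⇒variationAt : ∀ {ξ T T′} → CaseAt ξ T T′ → VariationAt ξ (childLabels ξ T′) T T′
  caseAt⇒variationAt {ξ} {T} {T′} (inj₁ (leaf , T⊆T′ , T′⊆)) = inj₁ (leaf , λ η → mk⇔ (to η) (from η))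
    where
    to : ∀ η → η ∈ᵀ T′ → η ∈ᵀ T ⊎ ∃ λ n → n ∈ childLabels ξ T′ × η ≡ ξ ++ [ n ]
    to η η∈T′ = [ inj₁ , (λ c → inj₂ (childLabels-child ξ T′ c η∈T′)) ]′ (All-∈ᵀ T′⊆ η∈T′)
    from : ∀ η → η ∈ᵀ T ⊎ (∃ λ n → n ∈ childLabels ξ T′ × η ≡ ξ ++ [ n ]) → η ∈ᵀ T′
    from η (inj₁ η∈T) = All-∈ᵀ T⊆T′ η∈T
    from η (inj₂ (n , n∈F , refl)) = childLabels-sound ξ T′ n∈F
  caseAt⇒variationAt {ξ} {T} {T′} (inj₂ (¬leaf , kept , new , dropped)) =
    inj₂ (¬leaf , (λ η → mk⇔ (to η) (from η)) , F⊆T , droppedChild)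
    where
    to : ∀ η → η ∈ᵀ T′ → (η ∈ᵀ T × ¬ StrictExt ξ η) ⊎ ∃ λ n → n ∈ childLabels ξ T′ × η ≡ ξ ++ [ n ]
    to η η∈T′ = [ inj₁ , (λ (c , _) → inj₂ (childLabels-child ξ T′ c η∈T′)) ]′ (All-∈ᵀ new η∈T′)
    from : ∀ η → (η ∈ᵀ T × ¬ StrictExt ξ η) ⊎ (∃ λ n → n ∈ childLabels ξ T′ × η ≡ ξ ++ [ n ]) → η ∈ᵀ T′
    from η (inj₁ (η∈T , ¬ext)) = [ (λ ext → contradiction ext ¬ext) , id ]′ (All-∈ᵀ kept η∈T)
    from η (inj₂ (n , n∈F , refl)) = childLabels-sound ξ T′ n∈F
    F⊆T : ∀ n → n ∈ childLabels ξ T′ → (ξ ++ [ n ]) ∈ᵀ T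
    F⊆T n n∈F = [ (λ (_ , ¬ext) → contradiction (n , [] , refl) ¬ext) , proj₂ ]′ (All-∈ᵀ new (childLabels-sound ξ T′ n∈F))
    droppedChild : ∃ λ n → (ξ ++ [ n ]) ∈ᵀ T × ¬ (n ∈ childLabels ξ T′)
    droppedChild with find dropped
    ... | _ , q∈T , (n , refl) , ∉T′ = n , ∈⇒∈ᵀ q∈T , ∉T′ ∘ childLabels-sound ξ T′

  variationAt-children : ∀ {ξ F T T′} → VariationAt ξ F T T′ → ∀ n → n ∈ F → (ξ ++ [ n ]) ∈ᵀ T′
  variationAt-children (inj₁ (_ , iff)) n n∈F = Equivalence.from (iff _) (inj₂ (n , n∈F , refl))
  variationAt-children (inj₂ (_ , iff , _)) n n∈F = Equivalence.from (iff _) (inj₂ (n , n∈F , refl))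

  variationAt⇒caseAt : ∀ {ξ F T T′} → VariationAt ξ F T T′ → CaseAt ξ T T′
  variationAt⇒caseAt {ξ} {F} {T} {T′} (inj₁ (leaf , iff)) = inj₁ (leaf ,
    ∈ᵀ-All (λ η∈T → Equivalence.from (iff _) (inj₁ η∈T)) ,
    ∈ᵀ-All (λ η∈T′ → [ inj₁ , (λ (n , _ , e) → inj₂ (n , e)) ]′ (Equivalence.to (iff _) η∈T′)))
  variationAt⇒caseAt {ξ} {F} {T} {T′} (inj₂ (¬leaf , iff , F⊆T , (n₁ , n₁∈T , n₁∉F))) = inj₂ (¬leaf , kept , new , dropped)
    where
    kept : All (λ q → StrictExt ξ (proj₁ q) ⊎ proj₁ q ∈ᵀ T′) T
    kept = ∈ᵀ-All λ {η} η∈T → case (strictExtᵇ ξ η because strictExtᵇ-reflects ξ η) of λ where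
      (yes ext) → inj₁ ext
      (no ¬ext) → inj₂ (Equivalence.from (iff η) (inj₁ (η∈T , ¬ext)))
    new : All (λ q → (proj₁ q ∈ᵀ T × ¬ StrictExt ξ (proj₁ q)) ⊎ (IsChild ξ (proj₁ q) × proj₁ q ∈ᵀ T)) T′
    new = ∈ᵀ-All λ η∈T′ → [ inj₁ , (λ { (n , n∈F , refl) → inj₂ ((n , refl) , F⊆T n n∈F) }) ]′ (Equivalence.to (iff _) η∈T′)
    dropped : Any (λ q → IsChild ξ (proj₁ q) × ¬ (proj₁ q ∈ᵀ T′)) T
    dropped = let _ , j = ∈ᵀ⇒∈ n₁∈T in lose j ((n₁ , refl) , λ ∈T′ →
      [ (λ (_ , ¬ext) → ¬ext (n₁ , [] , refl)) , (λ (n , n∈F , e) → n₁∉F (subst (_∈ F) (sym (∷ʳ-injectiveʳ ξ ξ e)) n∈F)) ]′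
        (Equivalence.to (iff _) ∈T′))

  oneStepAt⇒oneStep : ∀ {T T′} → Any (λ p → OneStepAt (proj₁ p) T T′) T → OneStep T T′
  oneStepAt⇒oneStep {T} {T′} at with find at
  ... | (ξ , _) , p∈T , hasChild , case′ with find hasChild
  ...   | _ , q∈T′ , child = let n , n∈F , _ = childLabels-child ξ T′ child (∈⇒∈ᵀ q∈T′) in
    ξ , ∈⇒∈ᵀ p∈T , childLabels ξ T′ , (n , n∈F) , caseAt⇒variationAt case′

  oneStep⇒oneStepAt : ∀ {T T′} → OneStep T T′ → Any (λ p → OneStepAt (proj₁ p) T T′) T
  oneStep⇒oneStepAt {T} {T′} (ξ , ξ∈T , F , (n₀ , n₀∈F) , var) =
    let _ , p∈T = ∈ᵀ⇒∈ ξ∈T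
        _ , c∈T′ = ∈ᵀ⇒∈ (variationAt-children var n₀ n₀∈F)
    in lose p∈T (lose c∈T′ (n₀ , refl) , variationAt⇒caseAt var)

  leafCaseᵇ : Node → Step m → Step m → Bool
  leafCaseᵇ ξ T T′ = allᵇ (λ q → proj₁ q ∈ᵀᵇ T′) T ∧ allᵇ (λ q → (proj₁ q ∈ᵀᵇ T) ∨ childᵇ ξ (proj₁ q)) T′

  nonLeafCaseᵇ : Node → Step m → Step m → Bool
  nonLeafCaseᵇ ξ T T′ =
    allᵇ (λ q → strictExtᵇ ξ (proj₁ q) ∨ (proj₁ q ∈ᵀᵇ T′)) T ∧
    (allᵇ (λ q → ((proj₁ q ∈ᵀᵇ T) ∧ not (strictExtᵇ ξ (proj₁ q))) ∨ (childᵇ ξ (proj₁ q) ∧ (proj₁ q ∈ᵀᵇ T))) T′ ∧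
     anyᵇ (λ q → childᵇ ξ (proj₁ q) ∧ not (proj₁ q ∈ᵀᵇ T′)) T)

  leafCaseᵇ-reflects : ∀ ξ T T′ → Reflects (LeafCase ξ T T′) (leafCaseᵇ ξ T T′)
  leafCaseᵇ-reflects ξ T T′ =
    allᵇ-reflects (λ q → ∈ᵀᵇ-reflects (proj₁ q) T′) T ×-reflects
    allᵇ-reflects (λ q → ∈ᵀᵇ-reflects (proj₁ q) T ⊎-reflects childᵇ-reflects ξ (proj₁ q)) T′

  nonLeafCaseᵇ-reflects : ∀ ξ T T′ → Reflects (NonLeafCase ξ T T′) (nonLeafCaseᵇ ξ T T′)
  nonLeafCaseᵇ-reflects ξ T T′ =
    allᵇ-reflects (λ q → strictExtᵇ-reflects ξ (proj₁ q) ⊎-reflects ∈ᵀᵇ-reflects (proj₁ q) T′) T ×-reflects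
    (allᵇ-reflects (λ q → (∈ᵀᵇ-reflects (proj₁ q) T ×-reflects ¬-reflects (strictExtᵇ-reflects ξ (proj₁ q))) ⊎-reflects
                           (childᵇ-reflects ξ (proj₁ q) ×-reflects ∈ᵀᵇ-reflects (proj₁ q) T)) T′ ×-reflects
     anyᵇ-reflects (λ q → childᵇ-reflects ξ (proj₁ q) ×-reflects ¬-reflects (∈ᵀᵇ-reflects (proj₁ q) T′)) T)

  oneStepAtᵇ : Node → Step m → Step m → Bool
  oneStepAtᵇ ξ T T′ = anyᵇ (λ q → childᵇ ξ (proj₁ q)) T′ ∧ (if isLeafᵇ ξ T then leafCaseᵇ ξ T T′ else nonLeafCaseᵇ ξ T T′)

  oneStepAtᵇ-reflects : ∀ ξ T T′ → Reflects (OneStepAt ξ T T′) (oneStepAtᵇ ξ T T′)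
  oneStepAtᵇ-reflects ξ T T′ =
    anyᵇ-reflects (λ q → childᵇ-reflects ξ (proj₁ q)) T′ ×-reflects
    if-reflects (isLeafᵇ-reflects ξ T) (leafCaseᵇ-reflects ξ T T′) (nonLeafCaseᵇ-reflects ξ T T′)

  oneStepᵇ : Step m → Step m → Bool
  oneStepᵇ T T′ = anyᵇ (λ p → oneStepAtᵇ (proj₁ p) T T′) T

  oneStepᵇ-reflects : ∀ T T′ → Reflects (OneStep T T′) (oneStepᵇ T T′)
  oneStepᵇ-reflects T T′ =
    reflects-map oneStepAt⇒oneStep oneStep⇒oneStepAt (anyᵇ-reflects (λ p → oneStepAtᵇ-reflects (proj₁ p) T T′) T)

  stepᵇ : (G m → Bool) → (G m → G m → Bool) → Step m → Step m → Bool
  stepᵇ valid le T T′ = validStepᵇ valid le T′ ∧ (oneStepᵇ T T′ ∧ agreeᵇ T T′)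

  root : Step m
  root = [ ([] , ζ m) ]

  pathᵇ : (G m → Bool) → (G m → G m → Bool) → G (suc m) → Bool
  pathᵇ valid le γ = codeEqᵇ (list (entry m)) (headOr [] γ) root ∧ linkedᵇ [] (stepᵇ valid le) γ

  module _ {valid : G m → Bool} {le : G m → G m → Bool}
           (valid-r : ∀ v → Reflects (Valid m v) (valid v)) (le-r : ∀ v w → Reflects (Le m v w) (le v w)) where
    pathFrom-reflects : ∀ T Ts → Reflects (PathFrom m T Ts) (linkedFromᵇ (stepᵇ valid le) T Ts)
    pathFrom-reflects T [] = ofʸ tt
    pathFrom-reflects T (T′ ∷ Ts) =
      reflects-map (λ ((a , b , c) , d) → a , b , c , d) (λ (a , b , c , d) → (a , b , c) , d)
        ((validStepᵇ-reflects valid-r le-r T′ ×-reflects (oneStepᵇ-reflects T T′ ×-reflects agreeᵇ-reflects T T′))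
         ×-reflects pathFrom-reflects T′ Ts)

    pathᵇ-reflects : ∀ γ → Reflects (IsPath m γ) (pathᵇ valid le γ)
    pathᵇ-reflects [] = ofⁿ λ ()
    pathᵇ-reflects (T ∷ Ts) =
      subst (Reflects _) (cong (codeEqᵇ (list (entry m)) T root ∧_) (sym (foldl-linkedStep [] (stepᵇ valid le) true T Ts)))
        (codeEqᵇ-reflects (list (entry m)) T root ×-reflects pathFrom-reflects T Ts)

null-reflects : {A : Set} (xs : List A) → Reflects (xs ≡ []) (null xs)
null-reflects [] = ofʸ refl
null-reflects (x ∷ xs) = ofⁿ λ ()

valid₀ᵇ-reflects : ∀ γ → Reflects (Valid zero γ) (linkedᵇ (default (pair nat fin3)) (λ p q → proj₁ p <ᵇ proj₁ q) γ)
valid₀ᵇ-reflects = linkedᵇ-reflects (default (pair nat fin3)) (λ p q → <ᵇ-reflects-< (proj₁ p) (proj₁ q))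

le₀ᵇ-reflects : ∀ γ δ → Reflects (Le zero γ δ) (null γ ∨ codeEqᵇ (gam zero) γ δ)
le₀ᵇ-reflects γ δ = null-reflects γ ⊎-reflects codeEqᵇ-reflects (gam zero) γ δ

leSᵇ-reflects : ∀ m γ δ → Reflects (Le (suc m) γ δ) (isPrefixᵇ [] (codeEqᵇ (list (entry m))) γ δ)
leSᵇ-reflects m = isPrefixᵇ-reflects [] (codeEqᵇ-reflects (list (entry m)))

over₀ᵇ-reflects : ∀ k γ → Reflects (Over zero k γ) (allᵇ (λ p → k <ᵇ proj₁ p) γ)
over₀ᵇ-reflects k γ = reflects-map (λ a h h≡γ → subst (All _) (sym h≡γ) a) (λ over → over γ refl)
  (allᵇ-reflects (λ p → <ᵇ-reflects-< k (proj₁ p)) γ)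

-- Only the leaves of the last tree of a computation path contribute to its interpretation.
overSᵇ : ∀ m → (ℕ → G m → Bool) → ℕ → G (suc m) → Bool
overSᵇ m over k γ = allᵇ (λ p → not (isLeafᵇ (proj₁ p) (lastᵇ [] γ)) ∨ over k (proj₂ p)) (lastᵇ [] γ)

overSᵇ-reflects : ∀ m {over : ℕ → G m → Bool} → (∀ k w → Reflects (Over m k w) (over k w)) →
  ∀ k γ → Reflects (Over (suc m) k γ) (overSᵇ m over k γ)
overSᵇ-reflects m over-r k γ = reflects-map to from
  (allᵇ-reflects (λ p → isLeafᵇ-reflects (proj₁ p) (lastᵇ [] γ) →-reflects over-r k (proj₂ p)) (lastᵇ [] γ))
  where
  to : All (λ p → IsLeaf (proj₁ p) (lastᵇ [] γ) → Over m k (proj₂ p)) (lastᵇ [] γ) → Over (suc m) k γ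
  to a h (pre , T , refl , ξ , w , ξw∈T , leaf , int) rewrite lastᵇ-∷ʳ [] pre T = All.lookup a ξw∈T leaf h int
  from : Over (suc m) k γ → All (λ p → IsLeaf (proj₁ p) (lastᵇ [] γ) → Over m k (proj₂ p)) (lastᵇ [] γ)
  from over = All.tabulate λ {(ξ , w)} ξw∈L leaf h int →
    let pre , split = lastᵇ-split [] γ (λ { refl → case ξw∈L of λ () }) in over h (pre , _ , split , ξ , w , ξw∈L , leaf , int)

_∈ᵀᴾ_ : ∀ {m} → Prog Γ (list nat) → Prog Γ (list (entry m)) → Prog Γ bool
ξ ∈ᵀᴾ T = withSem (anyᴾ T (proj₁ᴾ v₀ ==ᴾ wkᴾ ξ)) (λ X ρ → sem ξ X ρ ∈ᵀᵇ sem T X ρ) (λ _ _ → refl)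

strictExtᴾ : Prog Γ (list nat) → Prog Γ (list nat) → Prog Γ bool
strictExtᴾ ξ η = withSem (isPrefixᴾ ξ η ∧ᴾ (lengthᴾ ξ <ᴾ lengthᴾ η)) (λ X ρ → strictExtᵇ (sem ξ X ρ) (sem η X ρ)) (λ _ _ → refl)

childᴾ : Prog Γ (list nat) → Prog Γ (list nat) → Prog Γ bool
childᴾ ξ η = withSem (isPrefixᴾ ξ η ∧ᴾ (sucᴾ (lengthᴾ ξ) ==ᴾ lengthᴾ η)) (λ X ρ → childᵇ (sem ξ X ρ) (sem η X ρ)) (λ _ _ → refl)

isLeafᴾ : ∀ {m} → Prog Γ (list nat) → Prog Γ (list (entry m)) → Prog Γ bool
isLeafᴾ ξ T = withSem (allᴾ T (notᴾ (strictExtᴾ (wkᴾ ξ) (proj₁ᴾ v₀)))) (λ X ρ → isLeafᵇ (sem ξ X ρ) (sem T X ρ)) (λ _ _ → refl)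

prefixClosedᴾ : ∀ {m} → Prog Γ (list (entry m)) → Prog Γ bool
prefixClosedᴾ T = withSem
  (allᴾ T (allBelowᴾ (sucᴾ (lengthᴾ (proj₁ᴾ v₀))) (anyᴾ (wk²ᴾ T) (isPrefixᴾ (proj₁ᴾ v₀) (proj₁ᴾ v₂) ∧ᴾ (lengthᴾ (proj₁ᴾ v₀) ==ᴾ v₁)))))
  (λ X ρ → prefixClosedᵇ (sem T X ρ)) (λ _ _ → refl)

validStepᴾ : ∀ {m} → Prog (gam m ∷ []) bool → Prog (gam m ∷ gam m ∷ []) bool → Prog Γ (list (entry m)) → Prog Γ bool
validStepᴾ {Γ = Γ} {m = m} valid le T = withSem
  (sorted ∧ᴾ (prefixClosedᴾ T ∧ᴾ (allᴾ T (app₁ valid (proj₂ᴾ v₀)) ∧ᴾ (hasRoot ∧ᴾ monotone))))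
  (λ X ρ → validStepᵇ (λ v → sem valid X (v , tt)) (λ v w → sem le X (v , w , tt)) (sem T X ρ)) (λ _ _ → refl)
  where
  sorted : Prog Γ bool
  sorted = linkedᴾ T (lexᴾ (proj₁ᴾ v₀) (proj₁ᴾ v₁))
  hasRoot : Prog Γ bool
  hasRoot = anyᴾ T (lit (entry m) ([] , ζ m) ==ᴾ v₀)
  monotone : Prog Γ bool
  monotone = allᴾ T (allᴾ (wkᴾ T) (notᴾ (isPrefixᴾ (proj₁ᴾ v₁) (proj₁ᴾ v₀)) ∨ᴾ app₂ le (proj₂ᴾ v₁) (proj₂ᴾ v₀)))

agreeᴾ : ∀ {m} → Prog Γ (list (entry m)) → Prog Γ (list (entry m)) → Prog Γ bool
agreeᴾ T T′ = withSem (allᴾ T (allᴾ (wkᴾ T′) (notᴾ (proj₁ᴾ v₁ ==ᴾ proj₁ᴾ v₀) ∨ᴾ (proj₂ᴾ v₁ ==ᴾ proj₂ᴾ v₀))))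
  (λ X ρ → agreeᵇ (sem T X ρ) (sem T′ X ρ)) (λ _ _ → refl)

leafCaseᴾ : ∀ {m} → Prog Γ (list nat) → Prog Γ (list (entry m)) → Prog Γ (list (entry m)) → Prog Γ bool
leafCaseᴾ ξ T T′ = withSem
  (allᴾ T (proj₁ᴾ v₀ ∈ᵀᴾ wkᴾ T′) ∧ᴾ allᴾ T′ ((proj₁ᴾ v₀ ∈ᵀᴾ wkᴾ T) ∨ᴾ childᴾ (wkᴾ ξ) (proj₁ᴾ v₀)))
  (λ X ρ → leafCaseᵇ (sem ξ X ρ) (sem T X ρ) (sem T′ X ρ)) (λ _ _ → refl)

nonLeafCaseᴾ : ∀ {m} → Prog Γ (list nat) → Prog Γ (list (entry m)) → Prog Γ (list (entry m)) → Prog Γ bool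
nonLeafCaseᴾ ξ T T′ = withSem
  (allᴾ T (strictExtᴾ (wkᴾ ξ) (proj₁ᴾ v₀) ∨ᴾ (proj₁ᴾ v₀ ∈ᵀᴾ wkᴾ T′)) ∧ᴾ
   (allᴾ T′ (((proj₁ᴾ v₀ ∈ᵀᴾ wkᴾ T) ∧ᴾ notᴾ (strictExtᴾ (wkᴾ ξ) (proj₁ᴾ v₀))) ∨ᴾ
             (childᴾ (wkᴾ ξ) (proj₁ᴾ v₀) ∧ᴾ (proj₁ᴾ v₀ ∈ᵀᴾ wkᴾ T))) ∧ᴾ
    anyᴾ T (childᴾ (wkᴾ ξ) (proj₁ᴾ v₀) ∧ᴾ notᴾ (proj₁ᴾ v₀ ∈ᵀᴾ wkᴾ T′))))
  (λ X ρ → nonLeafCaseᵇ (sem ξ X ρ) (sem T X ρ) (sem T′ X ρ)) (λ _ _ → refl)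

oneStepᴾ : ∀ {m} → Prog Γ (list (entry m)) → Prog Γ (list (entry m)) → Prog Γ bool
oneStepᴾ T T′ = withSem
  (anyᴾ T (anyᴾ (wkᴾ T′) (childᴾ (proj₁ᴾ v₁) (proj₁ᴾ v₀)) ∧ᴾ
           (ifᴾ isLeafᴾ (proj₁ᴾ v₀) (wkᴾ T) then leafCaseᴾ (proj₁ᴾ v₀) (wkᴾ T) (wkᴾ T′)
            else nonLeafCaseᴾ (proj₁ᴾ v₀) (wkᴾ T) (wkᴾ T′))))
  (λ X ρ → oneStepᵇ (sem T X ρ) (sem T′ X ρ)) (λ _ _ → refl)

pathᴾ : ∀ {m} → Prog (gam m ∷ []) bool → Prog (gam m ∷ gam m ∷ []) bool → Prog Γ (list (list (entry m))) → Prog Γ bool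
pathᴾ {m = m} valid le γ = withSem
  ((headᴾ γ ==ᴾ lit (list (entry m)) root) ∧ᴾ linkedᴾ γ (validStepᴾ valid le v₁ ∧ᴾ (oneStepᴾ v₀ v₁ ∧ᴾ agreeᴾ v₀ v₁)))
  (λ X ρ → pathᵇ (λ v → sem valid X (v , tt)) (λ v w → sem le X (v , w , tt)) (sem γ X ρ)) (λ _ _ → refl)

leᴾ : ∀ m → Prog (gam m ∷ gam m ∷ []) bool
leᴾ zero = nullᴾ (unroll₀ᴾ v₀) ∨ᴾ (v₀ ==ᴾ v₁)
leᴾ (suc m) = isPrefixᴾ (unrollᴾ v₀) (unrollᴾ v₁)

validᴾ : ∀ m → Prog (gam m ∷ []) bool
validᴾ zero = linkedᴾ (unroll₀ᴾ v₀) (proj₁ᴾ v₀ <ᴾ proj₁ᴾ v₁)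
validᴾ (suc m) = pathᴾ (validᴾ m) (leᴾ m) (unrollᴾ v₀)

overᴾ : ∀ m → Prog (nat ∷ gam m ∷ []) bool
overᴾ zero = allᴾ (unroll₀ᴾ v₁) (v₁ <ᴾ proj₁ᴾ v₀)
overᴾ (suc m) = letᴾ (lastᴾ (unrollᴾ v₁)) (allᴾ v₀ (notᴾ (isLeafᴾ (proj₁ᴾ v₀) v₁) ∨ᴾ app₂ (overᴾ m) v₂ (proj₂ᴾ v₀)))

le-reflects : ∀ m X γ δ → Reflects (Le m γ δ) (sem (leᴾ m) X (γ , δ , tt))
le-reflects zero X = le₀ᵇ-reflects
le-reflects (suc m) X = leSᵇ-reflects m

valid-reflects : ∀ m X γ → Reflects (Valid m γ) (sem (validᴾ m) X (γ , tt))
valid-reflects zero X = valid₀ᵇ-reflects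
valid-reflects (suc m) X = pathᵇ-reflects (valid-reflects m X) (le-reflects m X)

over-reflects : ∀ m X k γ → Reflects (Over m k γ) (sem (overᴾ m) X (k , γ , tt))
over-reflects zero X = over₀ᵇ-reflects
over-reflects (suc m) X = overSᵇ-reflects m (over-reflects m X)

-- The order on Γ_m

Le-refl : ∀ m (γ : G m) → Le m γ γ
Le-refl zero γ = inj₂ refl
Le-refl (suc m) γ = [] , ++-identityʳ γ

≡⇒Le : ∀ m {γ δ : G m} → γ ≡ δ → Le m γ δ
≡⇒Le m {γ} refl = Le-refl m γ

Le-trans : ∀ m {γ δ ε : G m} → Le m γ δ → Le m δ ε → Le m γ ε
Le-trans zero (inj₁ γ≡ζ) _ = inj₁ γ≡ζ
Le-trans zero (inj₂ refl) δ≤ε = δ≤ε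
Le-trans (suc m) {γ} (ρ₁ , refl) (ρ₂ , refl) = ρ₁ ++ ρ₂ , sym (++-assoc γ ρ₁ ρ₂)

Le-antisym : ∀ m {γ δ : G m} → Le m γ δ → Le m δ γ → γ ≡ δ
Le-antisym zero (inj₂ γ≡δ) _ = γ≡δ
Le-antisym zero (inj₁ refl) (inj₁ refl) = refl
Le-antisym zero (inj₁ refl) (inj₂ δ≡γ) = sym δ≡γ
Le-antisym (suc m) {γ} (ρ₁ , refl) (ρ₂ , e) = begin
  γ        ≡⟨ ++-identityʳ γ ⟨
  γ ++ []  ≡⟨ cong (γ ++_) (++-conicalˡ ρ₁ ρ₂ (++-identityʳ-unique γ (sym (trans (sym (++-assoc γ ρ₁ ρ₂)) e)))) ⟨
  γ ++ ρ₁  ∎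

Le-mono : ∀ m (f : ℕ → G m) → (∀ s → Le m (f s) (f (suc s))) → ∀ {s t} → s ≤ t → Le m (f s) (f t)
Le-mono m f step {s} s≤t = upward-closed (λ {t} fs≤ft → Le-trans m fs≤ft (step t)) s≤t (Le-refl m (f s))

ζ-valid : ∀ m → Valid m (ζ m)
ζ-valid zero = []
ζ-valid (suc m) = refl , tt

ζ-over : ∀ m n → Over m n (ζ m)
ζ-over zero n h refl = []
ζ-over (suc m) n h (pre , T , e , ξ , w , ξw∈T , _ , int) with ∷ʳ-injective pre [] e
... | refl , refl with ξw∈T
...   | here refl = ζ-over m n h int

-- The functional Ψ

module Construction (m : ℕ) (Ξ : PR 2) where
  State : Set
  State = Bool × G m

  attempt : Oracle → ℕ → ℕ → ℕ → ℕ
  attempt X s n t = sem (simulator (simulation Ξ)) X (s , n , t , tt)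

  candidate : Oracle → ℕ → G m
  candidate X r = sem (prog (decodeG m)) X (pred r , tt)

  acceptᵇ : Oracle → ℕ → ℕ → State → Bool
  acceptᵇ X n r (alive , γ) =
    alive ∧ (not (r ≡ᵇ 0) ∧ (sem (validᴾ m) X (candidate X r , tt) ∧
      (sem (overᴾ m) X (n , candidate X r , tt) ∧ sem (leᴾ m) X (γ , candidate X r , tt))))

  Acceptable : Oracle → ℕ → ℕ → State → Set
  Acceptable X n r (alive , γ) =
    T alive × r ≢ 0 × Valid m (candidate X r) × Over m n (candidate X r) × Le m γ (candidate X r)

  accept-reflects : ∀ X n r st → Reflects (Acceptable X n r st) (acceptᵇ X n r st)
  accept-reflects X n r (alive , γ) =
    T-reflects alive ×-reflects (¬-reflects (≡ᵇ-reflects r 0) ×-reflects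
      (valid-reflects m X (candidate X r) ×-reflects (over-reflects m X n (candidate X r) ×-reflects le-reflects m X γ (candidate X r))))

  acceptable? : ∀ X n r st → Dec (Acceptable X n r st)
  acceptable? X n r st = acceptᵇ X n r st because accept-reflects X n r st

  stepState : Oracle → ℕ → ℕ → State → State
  stepState X n r st = if acceptᵇ X n r st then (true , candidate X r) else (false , proj₂ st)

  state : Oracle → ℕ → ℕ → ℕ → State
  state X s n = natrec (true , ζ m) (λ t → stepState X n (attempt X s n t))

  Ψ : Oracle → ℕ → ℕ → G m
  Ψ X n s = proj₂ (state X s n s)

  Ψᴾ : Prog (nat ∷ nat ∷ []) (gam m)
  Ψᴾ = withSem (proj₂ᴾ (natrecᴾ v₁ (lit bool true ,ᴾ lit (gam m) (ζ m)) step)) (λ X (n , s , _) → Ψ X n s) (λ _ _ → refl)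
    where
    Ctx₄ : Ctx 4
    Ctx₄ = nat ∷ pair bool (gam m) ∷ nat ∷ nat ∷ []
    attemptᴾ : Prog Ctx₄ nat
    attemptᴾ = app₃ (simulator (simulation Ξ)) v₃ v₂ v₀
    candidateᴾ : Prog Ctx₄ (gam m)
    candidateᴾ = app₁ (prog (decodeG m)) (predᴾ attemptᴾ)
    acceptᴾ : Prog Ctx₄ bool
    acceptᴾ = proj₁ᴾ v₁ ∧ᴾ (notᴾ (isZeroᴾ attemptᴾ) ∧ᴾ (app₁ (validᴾ m) candidateᴾ ∧ᴾ
      (app₂ (overᴾ m) v₂ candidateᴾ ∧ᴾ app₂ (leᴾ m) (proj₂ᴾ v₁) candidateᴾ)))
    step : Prog Ctx₄ (pair bool (gam m))
    step = ifᴾ acceptᴾ then (lit bool true ,ᴾ candidateᴾ) else (lit bool false ,ᴾ proj₂ᴾ v₁)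

  Ψ-computes : ∀ X n s → Computes (term Ψᴾ) X n s (code m (Ψ X n s))
  Ψ-computes X n s = computes Ψᴾ X (n , s , tt)

  step-accept : ∀ {X n r st} → Acceptable X n r st → stepState X n r st ≡ (true , candidate X r)
  step-accept {X} {n} {r} {st} acc with acceptᵇ X n r st | accept-reflects X n r st
  ... | true | _ = refl
  ... | false | ofⁿ ¬acc = contradiction acc ¬acc

  step-reject : ∀ {X n r st} → ¬ Acceptable X n r st → stepState X n r st ≡ (false , proj₂ st)
  step-reject {X} {n} {r} {st} ¬acc with acceptᵇ X n r st | accept-reflects X n r st
  ... | true | ofʸ acc = contradiction acc ¬acc
  ... | false | _ = refl

  step-extends : ∀ X n r st → Le m (proj₂ st) (proj₂ (stepState X n r st))
  step-extends X n r st with acceptable? X n r st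
  ... | yes acc@(_ , _ , _ , _ , γ≤) rewrite step-accept acc = γ≤
  ... | no ¬acc rewrite step-reject ¬acc = Le-refl m (proj₂ st)

  state-valid-over : ∀ X s n k → Valid m (proj₂ (state X s n k)) × Over m n (proj₂ (state X s n k))
  state-valid-over X s n zero = ζ-valid m , ζ-over m n
  state-valid-over X s n (suc k) with acceptable? X n (attempt X s n k) (state X s n k)
  ... | yes acc@(_ , _ , valid , over , _) rewrite step-accept acc = valid , over
  ... | no ¬acc rewrite step-reject ¬acc = state-valid-over X s n k

  attempt-mono : ∀ X {s s′} n t → s ≤ s′ → attempt X s n t ≢ 0 → attempt X s′ n t ≡ attempt X s n t
  attempt-mono X {s} {s′} n t s≤s′ r≢0
    rewrite simulates (simulation Ξ) X s (n , t , tt) | simulates (simulation Ξ) X s′ (n , t , tt)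
    with eval s X Ξ (n ∷ t ∷ []) in e
  ... | nothing = contradiction refl r≢0
  ... | just y rewrite eval-mono X Ξ (n ∷ t ∷ []) s≤s′ e = refl

  state-suc-fuel : ∀ X s n k →
    Le m (proj₂ (state X s n k)) (proj₂ (state X (suc s) n k)) × (T (proj₁ (state X s n k)) → state X s n k ≡ state X (suc s) n k)
  state-suc-fuel X s n zero = Le-refl m (ζ m) , λ _ → refl
  state-suc-fuel X s n (suc k) with state-suc-fuel X s n k | acceptable? X n (attempt X s n k) (state X s n k)
  ... | _ , same | yes (alive , r≢0 , _) = ≡⇒Le m (cong proj₂ eq) , λ _ → eq
    where
    eq : state X s n (suc k) ≡ state X (suc s) n (suc k)
    eq = cong₂ (stepState X n) (sym (attempt-mono X n k (n≤1+n s) r≢0)) (same alive)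
  ... | γ≤γ′ , _ | no ¬acc rewrite step-reject ¬acc =
    Le-trans m γ≤γ′ (step-extends X n (attempt X (suc s) n k) (state X (suc s) n k)) , λ ()

  Ψ-isApprox : ∀ X → IsApproxFn m (Ψ X)
  Ψ-isApprox X =
    (λ n s → proj₁ (state-valid-over X s n s)) , (λ n → refl) ,
    (λ n s t → Le-mono m (Ψ X n) (λ s → Le-trans m (proj₁ (state-suc-fuel X s n s))
                                                    (step-extends X n (attempt X (suc s) n s) (state X (suc s) n s)))) ,
    (λ n s → proj₂ (state-valid-over X s n s))

-- Limits

eventually-constant : {A : Set} {_≼_ : A → A → Set} → (∀ {x y} → x ≼ y → y ≼ x → x ≡ y) →
  (f : ℕ → A) → (∀ {s t} → s ≤ t → f s ≼ f t) → ∀ {a} → (∀ K → ∃ λ j → K ≤ j × f j ≡ a) →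
  ∃ λ s₀ → ∀ s → s₀ ≤ s → f s ≡ a
eventually-constant {_≼_ = _≼_} antisym f mono {a} hits = let j₀ , _ , fj₀≡a = hits 0 in j₀ , λ s j₀≤s →
  let j , s≤j , fj≡a = hits s
  in trans (sym (antisym (mono j₀≤s) (subst (f s ≼_) (trans fj≡a (sym fj₀≡a)) (mono s≤j)))) fj₀≡a

module Convergence (m : ℕ) (Ξ : PR 2) (X : Oracle) (g : ℕ → ℕ → G m) (g-approx : IsApproxFn m g)
                   (g-computed : ∀ n s → Computes Ξ X n s (code m (g n s))) where
  open Construction m Ξ

  g-valid : ∀ n s → Valid m (g n s)
  g-valid = proj₁ g-approx

  g-zero : ∀ n → g n 0 ≡ ζ m
  g-zero = proj₁ (proj₂ g-approx)

  g-mono : ∀ n s t → s ≤ t → Le m (g n s) (g n t)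
  g-mono = proj₁ (proj₂ (proj₂ g-approx))

  g-over : ∀ n s → Over m n (g n s)
  g-over = proj₂ (proj₂ (proj₂ g-approx))

  fuel : ℕ → ℕ → ℕ
  fuel n t = proj₁ (g-computed n t)

  maxFuel : ℕ → ℕ → ℕ
  maxFuel n k = natrec 0 (λ t acc → acc ⊔ fuel n t) k

  fuel≤maxFuel : ∀ n {t k} → t < k → fuel n t ≤ maxFuel n k
  fuel≤maxFuel n {t} {suc k} t<1+k with m≤n⇒m<n∨m≡n (s≤s⁻¹ t<1+k)
  ... | inj₁ t<k = ≤-trans (fuel≤maxFuel n t<k) (m≤m⊔n (maxFuel n k) (fuel n k))
  ... | inj₂ refl = m≤n⊔m (maxFuel n k) (fuel n k)

  attempt-converged : ∀ {s n t} → fuel n t ≤ s → attempt X s n t ≡ suc (code m (g n t))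
  attempt-converged {s} {n} {t} le
    rewrite simulates (simulation Ξ) X s (n , t , tt) | eval-mono X Ξ (n ∷ t ∷ []) le (proj₂ (g-computed n t)) = refl

  attempt-nonzero : ∀ {s n t} → attempt X s n t ≢ 0 → attempt X s n t ≡ suc (code m (g n t))
  attempt-nonzero {s} {n} {t} r≢0 rewrite simulates (simulation Ξ) X s (n , t , tt) with eval s X Ξ (n ∷ t ∷ []) in e
  ... | nothing = contradiction refl r≢0
  ... | just y = cong suc (eval-det s (fuel n t) X Ξ (n ∷ t ∷ []) e (proj₂ (g-computed n t)))

  candidate-code : ∀ γ → candidate X (suc (code m γ)) ≡ γ
  candidate-code = decodes (decodeG m) X

  state-saturated : ∀ s n k → maxFuel n k ≤ s → state X s n k ≡ (true , g n (pred k))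
  state-saturated s n zero _ = cong (true ,_) (sym (g-zero n))
  state-saturated s n (suc k) le rewrite state-saturated s n k (≤-trans (m≤m⊔n (maxFuel n k) (fuel n k)) le)
                                       | attempt-converged (≤-trans (fuel≤maxFuel n ≤-refl) le) =
    trans (step-accept acceptable) (cong (true ,_) (candidate-code (g n k)))
    where
    acceptable : Acceptable X n (suc (code m (g n k))) (true , g n (pred k))
    acceptable rewrite candidate-code (g n k) = tt , (λ ()) , g-valid n k , g-over n k , g-mono n (pred k) k pred[n]≤n

  state-tracks : ∀ s n k₀ d → proj₂ (state X s n (k₀ + d)) ≡ proj₂ (state X s n k₀) ⊎
                                ∃ λ t → k₀ ≤ t × proj₂ (state X s n (k₀ + d)) ≡ g n t
  state-tracks s n k₀ zero = inj₁ (cong (proj₂ ∘ state X s n) (+-identityʳ k₀))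
  state-tracks s n k₀ (suc d) rewrite +-suc k₀ d with acceptable? X n (attempt X s n (k₀ + d)) (state X s n (k₀ + d))
  ... | yes acc@(_ , r≢0 , _) = inj₂ (k₀ + d , m≤m+n k₀ d , (begin
    proj₂ (stepState X n (attempt X s n (k₀ + d)) (state X s n (k₀ + d))) ≡⟨ cong proj₂ (step-accept acc) ⟩
    candidate X (attempt X s n (k₀ + d))                                   ≡⟨ cong (candidate X) (attempt-nonzero r≢0) ⟩
    candidate X (suc (code m (g n (k₀ + d))))                              ≡⟨ candidate-code (g n (k₀ + d)) ⟩
    g n (k₀ + d)                                                           ∎))
  ... | no ¬acc rewrite step-reject ¬acc = state-tracks s n k₀ d

  Ψ-tracks : ∀ n K s → suc K ⊔ maxFuel n (suc K) ≤ s → ∃ λ j → K ≤ j × Ψ X n s ≡ g n j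
  Ψ-tracks n K s le =
    [ (λ e → K , ≤-refl , trans (at-s e) (cong proj₂ saturated)) , (λ (j , K<j , e) → j , <⇒≤ K<j , at-s e) ]′
      (state-tracks s n (suc K) (s ∸ suc K))
    where
    saturated : state X s n (suc K) ≡ (true , g n K)
    saturated = state-saturated s n (suc K) (≤-trans (m≤n⊔m (suc K) (maxFuel n (suc K))) le)
    at-s : ∀ {γ} → proj₂ (state X s n (suc K + (s ∸ suc K))) ≡ γ → Ψ X n s ≡ γ
    at-s {γ} = subst (λ k → proj₂ (state X s n k) ≡ γ) (m+[n∸m]≡n (≤-trans (m≤m⊔n (suc K) (maxFuel n (suc K))) le))

  Ψ-code-cofinal : ∀ n c → ConvergesTo (term Ψᴾ) X n c → ∀ K → ∃ λ j → K ≤ j × code m (g n j) ≡ c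
  Ψ-code-cofinal n c (s₀ , conv) K =
    let s = s₀ ⊔ (suc K ⊔ maxFuel n (suc K))
        j , K≤j , Ψ≡g = Ψ-tracks n K s (m≤n⊔m s₀ _)
    in j , K≤j , trans (cong (code m) (sym Ψ≡g)) (outputs-det {t = term Ψᴾ} (Ψ-computes X n s) (conv s (m≤m⊔n s₀ _)))

  sameLimit : SameLimit Ξ (term Ψᴾ) X
  sameLimit n c = mk⇔ Ξ⇒Ψ Ψ⇒Ξ
    where
    Ξ⇒Ψ : ConvergesTo Ξ X n c → ConvergesTo (term Ψᴾ) X n c
    Ξ⇒Ψ (s₀ , conv) = suc s₀ ⊔ maxFuel n (suc s₀) , λ s le →
      let j , s₀≤j , Ψ≡g = Ψ-tracks n s₀ s le
      in subst (Computes (term Ψᴾ) X n s) (trans (cong (code m) Ψ≡g) (outputs-det {t = Ξ} (g-computed n j) (conv j s₀≤j)))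
               (Ψ-computes X n s)

    Ψ⇒Ξ : ConvergesTo (term Ψᴾ) X n c → ConvergesTo Ξ X n c
    Ψ⇒Ξ conv =
      let j₀ , _ , e₀ = cofinal 0
          s₁ , g≡gj₀ = eventually-constant (Le-antisym m) (g n) (λ {s} {t} → g-mono n s t)
                         (λ K → let j , K≤j , e = cofinal K in j , K≤j , code-injective m (trans e (sym e₀)))
      in s₁ , λ s le → subst (Computes Ξ X n s) (trans (cong (code m) (g≡gj₀ s le)) e₀) (g-computed n s)
      where
      cofinal : ∀ K → ∃ λ j → K ≤ j × code m (g n j) ≡ c
      cofinal = Ψ-code-cofinal n c conv

mainTheorem9 : (m : ℕ) (Ξ : PR 2) → ∃ λ (Ψ : PR 2) →
    IsΓFunctional m Ψ × (∀ X → IsApproxOf m Ξ X → SameLimit Ξ Ψ X)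
mainTheorem9 m Ξ = term Ψᴾ , (λ X → Ψ X , Ψ-isApprox X , Ψ-computes X) ,
                   λ X (g , g-approx , g-computed) → Convergence.sameLimit m Ξ X g g-approx g-computed
  where open Construction m Ξ
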